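{- Let $k,\ell\ge0$ be integers and let $P(x,y)=\sum_{n\ge0}\sum_{\pi\in\mathcal{S}_n}y^{e(\pi)}x^n/n!$, where $e(\pi)$ is the number of occurrences of the segmented pattern $a_1a_2\cdots a_k\,a\,a_{k+1}\cdots a_{k+\ell}$ in $\pi$. Then $P$ is the solution of $$\frac{\partial P}{\partial x}=y\left(P-\frac{1-x^k}{1-x}\right)\left(P-\frac{1-x^{\ell}}{1-x}\right)+\frac{2-x^k-x^{\ell}}{1-x}P-\frac{1-x^k-x^{\ell}+x^{k+\ell}}{(1-x)^2}$$ with the initial condition $P(0,y)=1$.
   Context: $\mathcal{S}_n$ is the set of permutations of $\{1,\dots,n\}$ written as words $\pi_1\cdots\pi_n$ ($\mathcal{S}_0$ contains only the empty permutation). The pattern $a_1\cdots a_k\,a\,a_{k+1}\cdots a_{k+\ell}$ is built on the poset whose only relations are $a<a_i$ for all $i$. An occurrence of it in $\pi\in\mathcal{S}_n$ is a factor $\pi_i\pi_{i+1}\cdots\pi_{i+k+\ell}$ of $k+\ell+1$ consecutive letters (with $i+k+\ell\le n$) such that $\pi_{i+k}<\pi_{i+t}$ for all $t\in\{0,\dots,k+\ell\}\setminus\{k\}$, i.e. its $(k+1)$-st letter is smaller than all its other letters. -}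

module Defs where

open import Data.Bool using (Bool; true; false; _∧_; if_then_else_)
open import Data.Nat using (ℕ; zero; suc; _∸_; _≤ᵇ_; _<ᵇ_; _≡ᵇ_; _≟_; _!)
import Data.Nat as ℕ
open import Data.Nat.Properties using (_!≢0)
open import Data.List using (List; []; _∷_; length; filter; take; drop; map; concatMap; upTo)
open import Data.List.Relation.Unary.Unique.DecPropositional _≟_ using (unique?)
open import Data.Integer using (+_)
open import Relation.Binary.PropositionalEquality using (_≡_)
open import Data.Rational using (ℚ; 0ℚ; 1ℚ; _+_; _-_; _*_; _/_)

words : ℕ → ℕ → List (List ℕ)
words zero    m = [] ∷ []
words (suc l) m = concatMap (λ a → map (a ∷_) (words l m)) (map suc (upTo m))

perms : ℕ → List (List ℕ)
perms n = filter unique? (words n n)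

allB : (ℕ → Bool) → List ℕ → Bool
allB p []       = true
allB p (x ∷ xs) = p x ∧ allB p xs

-- does the word s start with an occurrence (a factor of k+ℓ+1 letters
-- whose (k+1)-st letter is smaller than all its other letters)?
occursAtStart : ℕ → ℕ → List ℕ → Bool
occursAtStart k l s with drop k s
... | []       = false
... | c ∷ rest = (suc (k ℕ.+ l) ≤ᵇ length s)
                 ∧ allB (c <ᵇ_) (take k s)
                 ∧ allB (c <ᵇ_) (take l rest)

occ : ℕ → ℕ → List ℕ → ℕ
occ k l []       = 0
occ k l (x ∷ xs) = (if occursAtStart k l (x ∷ xs) then 1 else 0) ℕ.+ occ k l xs

count : ℕ → ℕ → ℕ → ℕ → ℕ
count k l n j = length (filter (λ π → occ k l π ≟ j) (perms n))

-- Formal power series in x, y with rational coefficients: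
-- f n j is the coefficient of xⁿ yʲ.

Series : Set
Series = ℕ → ℕ → ℚ

infix 4 _≐_
_≐_ : Series → Series → Set
f ≐ g = ∀ n j → f n j ≡ g n j

sumTo : ℕ → (ℕ → ℚ) → ℚ
sumTo zero    f = f 0
sumTo (suc n) f = sumTo n f + f (suc n)

infixl 6 _⊕_ _⊖_
infixl 7 _⊛_

_⊕_ : Series → Series → Series
(f ⊕ g) n j = f n j + g n j

_⊖_ : Series → Series → Series
(f ⊖ g) n j = f n j - g n j

_⊛_ : Series → Series → Series
(f ⊛ g) n j = sumTo n (λ a → sumTo j (λ b → f a b * g (n ∸ a) (j ∸ b)))

X^ : ℕ → Series
X^ m n zero    = if (m ≡ᵇ n) then 1ℚ else 0ℚ
X^ m n (suc j) = 0ℚ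

const : ℚ → Series
const c zero zero = c
const c _    _    = 0ℚ

Y : Series
Y zero (suc zero) = 1ℚ
Y _    _          = 0ℚ

∂x : Series → Series
∂x f n j = (+ (suc n) / 1) * f (suc n) j

inv1-X : Series
inv1-X n zero    = 1ℚ
inv1-X n (suc j) = 0ℚ

P : ℕ → ℕ → Series
P k l n j = (+ count k l n j / (n !)) {{n !≢0}}

module Submission where

-- Cut π ∈ 𝒮ₙ₊₁ at its least letter, π = σ m τ. An occurrence containing m must have m as its
-- distinguished letter, so e(π) = e(σ) + e(τ) + δ with δ = [k ≤ |σ|][ℓ ≤ |τ|]. Choosing the letters
-- of σ in C(n, i) ways and standardising σ and τ, the numbers c(n, j) = #{π ∈ 𝒮ₙ : e(π) = j} obey
--   c(n+1, j) = Σᵢ C(n, i) Σ_{u + v + δᵢ = j} c(i, u) c(n−i, v),   δᵢ = [k ≤ i][ℓ ≤ n−i],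
-- that is, [xⁿ] ∂ₓP = Σᵢ [xⁱ]P · y^δᵢ [xⁿ⁻ⁱ]P. Permutations of length at most k + ℓ have no
-- occurrence, so [xᵐ]P = 1 for m ≤ k + ℓ; hence (1 − xᵏ)/(1 − x) = 1 + ⋯ + xᵏ⁻¹ is the part of P
-- below degree k, and P − (1 − xᵏ)/(1 − x) keeps exactly the rows i ≥ k. Expanding the right-hand
-- side accordingly, it matches the sum above term by term after a case split on i < k and n − i < ℓ.

open import Defs

open import Data.Nat using (ℕ; zero; suc; _≤_)
open import Relation.Binary.PropositionalEquality using (_≡_)
open import Algebra.Core using (Op₂)
open import Algebra.Structures using (IsCommutativeSemiring)

module Comparisons where

  open import Data.Bool using (Bool; true; false; if_then_else_)
  open import Data.Nat using (ℕ; zero; suc; _+_; _∸_; _≤_; _<_; _≤ᵇ_; _<ᵇ_; _≡ᵇ_; _≤?_; _<?_; _≟_; s≤s)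
  open import Relation.Binary.PropositionalEquality using (_≡_; _≢_; refl; trans)
  open import Relation.Nullary.Decidable using (dec-true; dec-false)
  open import Relation.Nullary.Negation using (¬_)

  ⟦_⟧ : Bool → ℕ
  ⟦ b ⟧ = if b then 1 else 0

  -- `does (m ≤? n)` computes to `m ≤ᵇ n`, and likewise for `_<?_` and `_≟_`.
  ≤ᵇ-true : ∀ {m n} → m ≤ n → (m ≤ᵇ n) ≡ true
  ≤ᵇ-true = dec-true (_ ≤? _)

  ≤ᵇ-false : ∀ {m n} → ¬ m ≤ n → (m ≤ᵇ n) ≡ false
  ≤ᵇ-false = dec-false (_ ≤? _)

  <ᵇ-true : ∀ {m n} → m < n → (m <ᵇ n) ≡ true
  <ᵇ-true = dec-true (_ <? _)

  <ᵇ-false : ∀ {m n} → ¬ m < n → (m <ᵇ n) ≡ false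
  <ᵇ-false = dec-false (_ <? _)

  ≡ᵇ-true : ∀ {m n} → m ≡ n → (m ≡ᵇ n) ≡ true
  ≡ᵇ-true = dec-true (_ ≟ _)

  ≡ᵇ-false : ∀ {m n} → m ≢ n → (m ≡ᵇ n) ≡ false
  ≡ᵇ-false = dec-false (_ ≟ _)

  <ᵇ-suc : ∀ m n → (m <ᵇ suc n) ≡ (m ≤ᵇ n)
  <ᵇ-suc zero    n = refl
  <ᵇ-suc (suc m) n = refl

  ⟦+≡ᵇ⟧ : ∀ s v j → ⟦ s + v ≡ᵇ j ⟧ ≡ (if s ≤ᵇ j then ⟦ v ≡ᵇ j ∸ s ⟧ else 0)
  ⟦+≡ᵇ⟧ zero    v j       = refl
  ⟦+≡ᵇ⟧ (suc s) v zero    = refl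
  ⟦+≡ᵇ⟧ (suc s) v (suc j) rewrite <ᵇ-suc s j = ⟦+≡ᵇ⟧ s v j

  ≤ᵇ-∸ : ∀ {u j} d → u ≤ j → (u + d ≤ᵇ j) ≡ (d ≤ᵇ j ∸ u)
  ≤ᵇ-∸ {zero}          d _         = refl
  ≤ᵇ-∸ {suc u} {suc j} d (s≤s u≤j) = trans (<ᵇ-suc (u + d) j) (≤ᵇ-∸ d u≤j)

open Comparisons

module Lists where

  open import Data.Nat using (_+_; _*_; _≤_; _<_; s≤s)
  open import Data.Nat.Properties using (*-distribʳ-+)
  open import Data.Nat.ListAction using (sum)
  open import Data.Nat.ListAction.Properties using (sum-++; sum-↭)
  open import Data.Bool using (true; false)
  open import Data.List using (List; []; _∷_; _++_; map; concatMap; length; filter; take; drop)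
  open import Data.List.Properties using (map-++; map-cong-local; length-++)
  import Data.List.Relation.Unary.All as All
  open import Data.List.Relation.Unary.AllPairs using ([]; _∷_)
  open import Data.List.Relation.Unary.Any using (here; there)
  open import Data.List.Relation.Unary.Unique.Propositional using (Unique)
  import Data.List.Relation.Unary.Unique.Propositional.Properties as Unique
  open import Data.List.Membership.Propositional using (_∈_; find)
  open import Data.List.Membership.Propositional.Properties using (∈-concatMap⁻)
  open import Data.List.Membership.Propositional.Properties.WithK using (unique∧set⇒bag)
  open import Data.List.Relation.Binary.BagAndSetEquality using (∼bag⇒↭)
  open import Data.List.Relation.Binary.Subset.Propositional using (_⊆_)
  open import Data.List.Relation.Binary.Permutation.Propositional using (_↭_)
  import Data.List.Relation.Binary.Permutation.Propositional.Properties as ↭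
  open import Data.Product using (∃₂; _,_)
  open import Function using (_∘_)
  open import Function.Bundles using (mk⇔)
  open import Relation.Nullary using (does)
  open import Relation.Unary using (Decidable)
  open import Relation.Binary.PropositionalEquality

  private
    variable
      A B : Set

  take-length-++ : ∀ (u : List A) {w} → take (length u) (u ++ w) ≡ u
  take-length-++ []      = refl
  take-length-++ (x ∷ u) = cong (x ∷_) (take-length-++ u)

  drop-length-++ : ∀ (u : List A) {w} → drop (length u) (u ++ w) ≡ w
  drop-length-++ []      = refl
  drop-length-++ (x ∷ u) = drop-length-++ u

  take-++ˡ : ∀ n (u : List A) {w} → n ≤ length u → take n (u ++ w) ≡ take n u
  take-++ˡ zero    u       _       = refl
  take-++ˡ (suc n) (x ∷ u) (s≤s n≤) = cong (x ∷_) (take-++ˡ n u n≤)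

  ∈-take-++∷ : ∀ {n} (u : List A) {x w} → length u < n → x ∈ take n (u ++ x ∷ w)
  ∈-take-++∷ {n = suc n} []      _        = here refl
  ∈-take-++∷ {n = suc n} (y ∷ u) (s≤s u<) = there (∈-take-++∷ u u<)

  split-∷ : ∀ n (s : List A) → n < length s → ∃₂ λ u c → ∃₂ λ v (_ : length u ≡ n) → s ≡ u ++ c ∷ v
  split-∷ zero    (c ∷ v) _        = [] , c , v , refl , refl
  split-∷ (suc n) (x ∷ s) (s≤s n<) with split-∷ n s n<
  ... | u , c , v , refl , refl = x ∷ u , c , v , refl , refl

  sum-map-++ : ∀ (g : A → ℕ) xs ys → sum (map g (xs ++ ys)) ≡ sum (map g xs) + sum (map g ys)
  sum-map-++ g xs ys = trans (cong sum (map-++ g xs ys)) (sum-++ (map g xs) (map g ys))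

  sum-map-concatMap : ∀ (g : B → ℕ) (F : A → List B) xs →
                      sum (map g (concatMap F xs)) ≡ sum (map (λ x → sum (map g (F x))) xs)
  sum-map-concatMap g F []       = refl
  sum-map-concatMap g F (x ∷ xs) =
    trans (sum-map-++ g (F x) (concatMap F xs)) (cong (sum (map g (F x)) +_) (sum-map-concatMap g F xs))

  sum-map-cong : ∀ {g h : A → ℕ} xs → (∀ {x} → x ∈ xs → g x ≡ h x) → sum (map g xs) ≡ sum (map h xs)
  sum-map-cong xs g≗h = cong sum (map-cong-local (All.tabulate g≗h))

  sum-map-↭ : ∀ (g : A → ℕ) {xs ys} → xs ↭ ys → sum (map g xs) ≡ sum (map g ys)
  sum-map-↭ g xs↭ys = sum-↭ (↭.map⁺ g xs↭ys)

  sum-map-*ʳ : ∀ (g : A → ℕ) c xs → sum (map (λ x → g x * c) xs) ≡ sum (map g xs) * c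
  sum-map-*ʳ g c []       = refl
  sum-map-*ʳ g c (x ∷ xs) = trans (cong (g x * c +_) (sum-map-*ʳ g c xs)) (sym (*-distribʳ-+ c (g x) _))

  sum-map-const : ∀ c (xs : List A) → sum (map (λ _ → c) xs) ≡ length xs * c
  sum-map-const c []       = refl
  sum-map-const c (x ∷ xs) = cong (c +_) (sum-map-const c xs)

  length-filter : ∀ {P : A → Set} (P? : Decidable P) xs →
                  length (filter P? xs) ≡ sum (map (λ x → ⟦ does (P? x) ⟧) xs)
  length-filter P? []       = refl
  length-filter P? (x ∷ xs) with does (P? x)
  ... | true  = cong suc (length-filter P? xs)
  ... | false = length-filter P? xs

  length-concatMap : ∀ (F : A → List B) xs → length (concatMap F xs) ≡ sum (map (length ∘ F) xs)
  length-concatMap F []       = refl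
  length-concatMap F (x ∷ xs) = trans (length-++ (F x)) (cong (length (F x) +_) (length-concatMap F xs))

  unique-⊆-⊇⇒↭ : ∀ {xs ys : List A} → Unique xs → Unique ys → xs ⊆ ys → ys ⊆ xs → xs ↭ ys
  unique-⊆-⊇⇒↭ uxs uys xs⊆ys ys⊆xs = ∼bag⇒↭ (unique∧set⇒bag uxs uys (mk⇔ xs⊆ys ys⊆xs))

  concatMap-unique : ∀ (F : A → List B) {xs} → Unique xs → (∀ {x} → x ∈ xs → Unique (F x)) →
                     (∀ {x y w} → x ∈ xs → y ∈ xs → w ∈ F x → w ∈ F y → x ≡ y) →
                     Unique (concatMap F xs)
  concatMap-unique F {[]}     _            _       _        = []
  concatMap-unique F {x ∷ xs} (x∉xs ∷ uxs) F-unique F-disjoint =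
    Unique.++⁺ (F-unique (here refl))
               (concatMap-unique F uxs (F-unique ∘ there) (λ x∈ y∈ → F-disjoint (there x∈) (there y∈)))
               (λ (w∈Fx , w∈rest) → let (y , y∈xs , w∈Fy) = find (∈-concatMap⁻ F w∈rest)
                                    in All.lookup x∉xs y∈xs (F-disjoint (here refl) (there y∈xs) w∈Fx w∈Fy))

module Occurrences where

  open import Data.Bool using (Bool; true; false; _∧_)
  open import Data.Bool.Properties using (∧-zeroʳ)
  open import Data.Nat using (_+_; _∸_; _≤_; _<_; _≤ᵇ_; _<ᵇ_; _≡ᵇ_; _<?_; s≤s; s≤s⁻¹)
  open import Data.Nat.Properties
  open import Data.List using (List; []; _∷_; _++_; length; take; drop)
  open import Data.List.Properties using (length-++; ++-assoc; drop-all)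
  open import Data.List.Relation.Unary.All using (All; []; _∷_)
  import Data.List.Relation.Unary.All.Properties as All
  open import Data.List.Relation.Unary.Any using (here; there)
  open import Data.List.Membership.Propositional using (_∈_)
  open import Data.List.Membership.Propositional.Properties using (∈-++⁺ʳ)
  open import Data.Product using (_,_)
  open import Relation.Binary using (tri<; tri≈; tri>)
  open import Relation.Binary.PropositionalEquality
  open import Relation.Nullary using (yes; no)
  open import Function using (_∘_)
  open import Data.Nat.Solver using (module +-*-Solver)
  open +-*-Solver using (solve; _:=_; _:+_)
  open Lists using (take-length-++; drop-length-++; take-++ˡ; ∈-take-++∷; split-∷)

  allB-< : ∀ {c xs} → All (c <_) xs → allB (c <ᵇ_) xs ≡ true
  allB-< []          = refl
  allB-< (c<x ∷ c<xs) rewrite <ᵇ-true c<x = allB-< c<xs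

  allB-≮ : ∀ {c x xs} → x ∈ xs → x ≤ c → allB (c <ᵇ_) xs ≡ false
  allB-≮ (here refl) x≤c rewrite <ᵇ-false (≤⇒≯ x≤c) = refl
  allB-≮ {c} {xs = y ∷ _} (there x∈) x≤c rewrite allB-≮ x∈ x≤c = ∧-zeroʳ (c <ᵇ y)

  suc[a+l]≤ᵇa+suc[b] : ∀ a l b → (suc (a + l) ≤ᵇ a + suc b) ≡ (l ≤ᵇ b)
  suc[a+l]≤ᵇa+suc[b] zero    zero    b = refl
  suc[a+l]≤ᵇa+suc[b] zero    (suc l) b = refl
  suc[a+l]≤ᵇa+suc[b] (suc a) l       b = suc[a+l]≤ᵇa+suc[b] a l b

  occursAtStart-[] : ∀ k l s → drop k s ≡ [] → occursAtStart k l s ≡ false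
  occursAtStart-[] k l s eq with drop k s | eq
  ... | _ | refl = refl

  occursAtStart-∷ : ∀ k l s {c rest} → drop k s ≡ c ∷ rest → occursAtStart k l s ≡
    (suc (k + l) ≤ᵇ length s) ∧ allB (c <ᵇ_) (take k s) ∧ allB (c <ᵇ_) (take l rest)
  occursAtStart-∷ k l s eq with drop k s | eq
  ... | _ | refl = refl

  occursAtStart-++∷ : ∀ l u c v → occursAtStart (length u) l (u ++ c ∷ v) ≡
    (l ≤ᵇ length v) ∧ allB (c <ᵇ_) u ∧ allB (c <ᵇ_) (take l v)
  occursAtStart-++∷ l u c v
    rewrite occursAtStart-∷ (length u) l (u ++ c ∷ v) (drop-length-++ u)
          | take-length-++ u {c ∷ v} | length-++ u {c ∷ v}
    = cong (_∧ allB (c <ᵇ_) u ∧ allB (c <ᵇ_) (take l v)) (suc[a+l]≤ᵇa+suc[b] (length u) l (length v))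

  occursAtStart-short : ∀ k l s → length s ≤ k + l → occursAtStart k l s ≡ false
  occursAtStart-short k l s s≤ with k <? length s
  ... | no k≮s = occursAtStart-[] k l s (drop-all k s (≮⇒≥ k≮s))
  ... | yes k<s with split-∷ k s k<s
  ...   | u , c , v , refl , refl
    rewrite occursAtStart-++∷ l u c v
          | ≤ᵇ-false (<⇒≱ (+-cancelˡ-≤ (length u) (suc (length v)) l
                              (subst (_≤ length u + l) (length-++ u) s≤)))
    = refl

  occursAtStart-++ : ∀ k l s t → k + l < length s → occursAtStart k l (s ++ t) ≡ occursAtStart k l s
  occursAtStart-++ k l s t k+l<s with split-∷ k s (≤-trans (s≤s (m≤m+n k l)) k+l<s)
  ... | u , c , v , refl , refl = begin
    occursAtStart (length u) l ((u ++ c ∷ v) ++ t)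
      ≡⟨ cong (occursAtStart (length u) l) (++-assoc u (c ∷ v) t) ⟩
    occursAtStart (length u) l (u ++ c ∷ v ++ t)
      ≡⟨ occursAtStart-++∷ l u c (v ++ t) ⟩
    (l ≤ᵇ length (v ++ t)) ∧ allB (c <ᵇ_) u ∧ allB (c <ᵇ_) (take l (v ++ t))
      ≡⟨ cong₂ (λ b w → b ∧ allB (c <ᵇ_) u ∧ allB (c <ᵇ_) w)
               (trans (≤ᵇ-true l≤v++t) (sym (≤ᵇ-true l≤v)))
               (take-++ˡ l v l≤v) ⟩
    (l ≤ᵇ length v) ∧ allB (c <ᵇ_) u ∧ allB (c <ᵇ_) (take l v)
      ≡⟨ occursAtStart-++∷ l u c v ⟨
    occursAtStart (length u) l (u ++ c ∷ v) ∎
    where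
    open ≡-Reasoning
    l≤v : l ≤ length v
    l≤v = s≤s⁻¹ (+-cancelˡ-< (length u) l (suc (length v)) (subst (_ <_) (length-++ u) k+l<s))
    l≤v++t : l ≤ length (v ++ t)
    l≤v++t = ≤-trans l≤v (subst (length v ≤_) (sym (length-++ v)) (m≤m+n (length v) (length t)))

  occursAtStart-min-before : ∀ {k} l σ {m τ} → All (m <_) τ → length σ < k →
                             occursAtStart k l (σ ++ m ∷ τ) ≡ false
  occursAtStart-min-before {k} l σ {m} {τ} m<τ σ<k with k <? length (σ ++ m ∷ τ)
  ... | no k≮ = occursAtStart-[] k l _ (drop-all k _ (≮⇒≥ k≮))
  ... | yes k< with split-∷ (k ∸ suc (length σ)) τ τ-long
    where
    τ-long : k ∸ suc (length σ) < length τ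
    τ-long = subst (k ∸ suc (length σ) <_) (m+n∸m≡n (suc (length σ)) (length τ))
               (∸-monoˡ-< (subst (k <_) (trans (length-++ σ) (+-suc _ _)) k<) σ<k)
  ...   | τ₁ , c , v , τ₁≡ , refl with All.++⁻ʳ τ₁ m<τ
  ...     | m<c ∷ _ = begin
    occursAtStart k l (σ ++ m ∷ τ₁ ++ c ∷ v)
      ≡⟨ cong₂ (λ i s → occursAtStart i l s) (sym prefix-length) (sym (++-assoc σ (m ∷ τ₁) (c ∷ v))) ⟩
    occursAtStart (length (σ ++ m ∷ τ₁)) l ((σ ++ m ∷ τ₁) ++ c ∷ v)
      ≡⟨ occursAtStart-++∷ l (σ ++ m ∷ τ₁) c v ⟩
    (l ≤ᵇ length v) ∧ allB (c <ᵇ_) (σ ++ m ∷ τ₁) ∧ allB (c <ᵇ_) (take l v)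
      ≡⟨ cong (λ b → (l ≤ᵇ length v) ∧ b ∧ _) (allB-≮ (∈-++⁺ʳ σ (here refl)) (<⇒≤ m<c)) ⟩
    (l ≤ᵇ length v) ∧ false
      ≡⟨ ∧-zeroʳ _ ⟩
    false ∎
    where
    open ≡-Reasoning
    prefix-length : length (σ ++ m ∷ τ₁) ≡ k
    prefix-length = begin
      length (σ ++ m ∷ τ₁)                      ≡⟨ length-++ σ ⟩
      length σ + suc (length τ₁)                ≡⟨ +-suc (length σ) _ ⟩
      suc (length σ) + length τ₁                ≡⟨ cong (suc (length σ) +_) τ₁≡ ⟩
      suc (length σ) + (k ∸ suc (length σ))     ≡⟨ m+[n∸m]≡n σ<k ⟩
      k                                         ∎

  occursAtStart-min-after : ∀ {k l} σ {m τ} → All (m <_) σ → k < length σ → length σ ≤ k + l →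
                            occursAtStart k l (σ ++ m ∷ τ) ≡ false
  occursAtStart-min-after {k} {l} σ {m} {τ} m<σ k<σ σ≤ with split-∷ k σ k<σ
  ... | u , c , σ₂ , refl , refl with All.++⁻ʳ u m<σ
  ...   | m<c ∷ _ = begin
    occursAtStart (length u) l ((u ++ c ∷ σ₂) ++ m ∷ τ)
      ≡⟨ cong (occursAtStart (length u) l) (++-assoc u (c ∷ σ₂) (m ∷ τ)) ⟩
    occursAtStart (length u) l (u ++ c ∷ σ₂ ++ m ∷ τ)
      ≡⟨ occursAtStart-++∷ l u c (σ₂ ++ m ∷ τ) ⟩
    (l ≤ᵇ length (σ₂ ++ m ∷ τ)) ∧ allB (c <ᵇ_) u ∧ allB (c <ᵇ_) (take l (σ₂ ++ m ∷ τ))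
      ≡⟨ cong (λ b → (l ≤ᵇ length (σ₂ ++ m ∷ τ)) ∧ allB (c <ᵇ_) u ∧ b) (allB-≮ (∈-take-++∷ σ₂ σ₂<l) (<⇒≤ m<c)) ⟩
    (l ≤ᵇ length (σ₂ ++ m ∷ τ)) ∧ allB (c <ᵇ_) u ∧ false
      ≡⟨ cong ((l ≤ᵇ length (σ₂ ++ m ∷ τ)) ∧_) (∧-zeroʳ (allB (c <ᵇ_) u)) ⟩
    (l ≤ᵇ length (σ₂ ++ m ∷ τ)) ∧ false
      ≡⟨ ∧-zeroʳ _ ⟩
    false ∎
    where
    open ≡-Reasoning
    σ₂<l : length σ₂ < l
    σ₂<l = +-cancelˡ-≤ (length u) (suc (length σ₂)) l (subst (_≤ length u + l) (length-++ u) σ≤)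

  occursAtStart-around-min : ∀ k l σ {m τ} → All (m <_) σ → All (m <_) τ →
    ⟦ occursAtStart k l (σ ++ m ∷ τ) ⟧ ≡ ⟦ occursAtStart k l σ ⟧ + ⟦ (l ≤ᵇ length τ) ∧ (length σ ≡ᵇ k) ⟧
  occursAtStart-around-min k l σ {m} {τ} m<σ m<τ with <-cmp (length σ) k
  ... | tri< σ<k σ≢k _
    rewrite occursAtStart-min-before l σ m<τ σ<k
          | occursAtStart-short k l σ (≤-trans (<⇒≤ σ<k) (m≤m+n k l))
          | ≡ᵇ-false σ≢k | ∧-zeroʳ (l ≤ᵇ length τ)
    = refl
  ... | tri≈ _ refl _
    rewrite occursAtStart-++∷ l σ m τ | allB-< m<σ | allB-< (All.take⁺ l m<τ)
          | occursAtStart-short (length σ) l σ (m≤m+n (length σ) l)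
          | ≡ᵇ-true (refl {x = length σ})
    = refl
  ... | tri> _ σ≢k k<σ with k + l <? length σ
  ...   | yes long
    rewrite occursAtStart-++ k l σ (m ∷ τ) long
          | ≡ᵇ-false σ≢k | ∧-zeroʳ (l ≤ᵇ length τ)
    = sym (+-identityʳ _)
  ...   | no short
    rewrite occursAtStart-min-after σ {τ = τ} m<σ k<σ (≮⇒≥ short)
          | occursAtStart-short k l σ (≮⇒≥ short)
          | ≡ᵇ-false σ≢k | ∧-zeroʳ (l ≤ᵇ length τ)
    = refl

  centred : ℕ → ℕ → ℕ → ℕ → ℕ
  centred k l a b = ⟦ (l ≤ᵇ b) ∧ (k ≤ᵇ a) ⟧

  centred-suc : ∀ k l a b → ⟦ (l ≤ᵇ b) ∧ (suc a ≡ᵇ k) ⟧ + centred k l a b ≡ centred k l (suc a) b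
  centred-suc k l a b with l ≤ᵇ b
  ... | false = refl
  ... | true with <-cmp k (suc a)
  ...   | tri< k<1+a k≢1+a _
    rewrite ≡ᵇ-false (k≢1+a ∘ sym) | ≤ᵇ-true (s≤s⁻¹ k<1+a) | ≤ᵇ-true (<⇒≤ k<1+a) = refl
  ...   | tri≈ _ refl _
    rewrite ≡ᵇ-true (refl {x = suc a}) | ≤ᵇ-false (<⇒≱ (n<1+n a)) | ≤ᵇ-true (≤-refl {suc a}) = refl
  ...   | tri> _ k≢1+a 1+a<k
    rewrite ≡ᵇ-false (k≢1+a ∘ sym) | ≤ᵇ-false (<⇒≱ (<-trans (n<1+n a) 1+a<k)) | ≤ᵇ-false (<⇒≱ 1+a<k) = refl

  centred-≥≥ : ∀ k l a b → k ≤ a → l ≤ b → centred k l a b ≡ 1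
  centred-≥≥ k l a b k≤a l≤b rewrite ≤ᵇ-true k≤a | ≤ᵇ-true l≤b = refl

  centred-<ˡ : ∀ k l a b → a < k → centred k l a b ≡ 0
  centred-<ˡ k l a b a<k rewrite ≤ᵇ-false (<⇒≱ a<k) | ∧-zeroʳ (l ≤ᵇ b) = refl

  centred-<ʳ : ∀ k l a b → b < l → centred k l a b ≡ 0
  centred-<ʳ k l a b b<l rewrite ≤ᵇ-false (<⇒≱ b<l) = refl

  occ-split : ∀ k l σ {m τ} → All (m <_) σ → All (m <_) τ →
              occ k l (σ ++ m ∷ τ) ≡ occ k l σ + occ k l τ + centred k l (length σ) (length τ)
  occ-split zero    l [] {τ = τ} _ m<τ =
    trans (cong (_+ occ zero l τ) (occursAtStart-around-min zero l [] [] m<τ)) (+-comm _ (occ zero l τ))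
  occ-split (suc k) l [] {τ = τ} _ m<τ =
    trans (cong (_+ occ (suc k) l τ) (occursAtStart-around-min (suc k) l [] [] m<τ)) (+-comm _ (occ (suc k) l τ))
  occ-split k l (x ∷ σ) {m} {τ} (m<x ∷ m<σ) m<τ = begin
    ⟦ occursAtStart k l (x ∷ σ ++ m ∷ τ) ⟧ + occ k l (σ ++ m ∷ τ)
      ≡⟨ cong₂ _+_ (occursAtStart-around-min k l (x ∷ σ) (m<x ∷ m<σ) m<τ) (occ-split k l σ m<σ m<τ) ⟩
    (a + c) + (o + t + centred k l (length σ) (length τ))
      ≡⟨ solve 5 (λ a c o t d → (a :+ c) :+ (o :+ t :+ d) := a :+ o :+ t :+ (c :+ d)) refl a c o t _ ⟩
    a + o + t + (c + centred k l (length σ) (length τ))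
      ≡⟨ cong (a + o + t +_) (centred-suc k l (length σ) (length τ)) ⟩
    a + o + t + centred k l (suc (length σ)) (length τ) ∎
    where
    open ≡-Reasoning
    a c o t : ℕ
    a = ⟦ occursAtStart k l (x ∷ σ) ⟧
    c = ⟦ (l ≤ᵇ length τ) ∧ (suc (length σ) ≡ᵇ k) ⟧
    o = occ k l σ
    t = occ k l τ

-- Parameterised by the summation operator itself, so that the lemmas apply verbatim both to
-- `sumToℕ` below and to `sumTo` from Defs.
module RangeSum {A : Set} {_+_ _*_ : Op₂ A} {0# 1# : A}
                (isCommutativeSemiring : IsCommutativeSemiring _≡_ _+_ _*_ 0# 1#)
                (∑ : ℕ → (ℕ → A) → A)
                (∑-zero : ∀ f → ∑ 0 f ≡ f 0)
                (∑-suc : ∀ n f → ∑ (suc n) f ≡ ∑ n f + f (suc n))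
                where

  open import Data.Nat using (_≤_; _∸_; z≤n; s≤s; _≟_)
  open import Function using (_∘_)
  open import Data.Nat.Properties using (≤-refl; ≤-trans; n≤1+n; ≤∧≢⇒<; <-irrefl; ≤-pred)
  open import Relation.Binary.PropositionalEquality
  open import Relation.Nullary using (yes; no)
  open IsCommutativeSemiring isCommutativeSemiring
    using (+-assoc; +-comm; +-identityˡ; +-identityʳ; distribˡ; +-isCommutativeSemigroup)
  open import Algebra.Bundles using (CommutativeSemigroup)
  open ≡-Reasoning

  private
    +-commutativeSemigroup : CommutativeSemigroup _ _
    +-commutativeSemigroup = record { isCommutativeSemigroup = +-isCommutativeSemigroup }

  open import Algebra.Properties.CommutativeSemigroup +-commutativeSemigroup using (interchange)

  ∑-cong : ∀ n {f g} → (∀ i → i ≤ n → f i ≡ g i) → ∑ n f ≡ ∑ n g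
  ∑-cong zero    {f} {g} f≗g = begin ∑ 0 f ≡⟨ ∑-zero f ⟩ f 0 ≡⟨ f≗g 0 z≤n ⟩ g 0 ≡⟨ ∑-zero g ⟨ ∑ 0 g ∎
  ∑-cong (suc n) {f} {g} f≗g = begin
    ∑ (suc n) f              ≡⟨ ∑-suc n f ⟩
    ∑ n f + f (suc n)        ≡⟨ cong₂ _+_ (∑-cong n (λ i i≤n → f≗g i (≤-trans i≤n (n≤1+n n)))) (f≗g (suc n) ≤-refl) ⟩
    ∑ n g + g (suc n)        ≡⟨ ∑-suc n g ⟨
    ∑ (suc n) g              ∎

  ∑-distrib-+ : ∀ n f g → ∑ n (λ i → f i + g i) ≡ ∑ n f + ∑ n g
  ∑-distrib-+ zero    f g rewrite ∑-zero (λ i → f i + g i) | ∑-zero f | ∑-zero g = refl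
  ∑-distrib-+ (suc n) f g
    rewrite ∑-suc n (λ i → f i + g i) | ∑-suc n f | ∑-suc n g | ∑-distrib-+ n f g
    = interchange (∑ n f) (∑ n g) (f (suc n)) (g (suc n))

  ∑-distribˡ : ∀ n c f → ∑ n (λ i → c * f i) ≡ c * ∑ n f
  ∑-distribˡ zero    c f rewrite ∑-zero (λ i → c * f i) | ∑-zero f = refl
  ∑-distribˡ (suc n) c f
    rewrite ∑-suc n (λ i → c * f i) | ∑-suc n f | ∑-distribˡ n c f
    = sym (distribˡ c (∑ n f) (f (suc n)))

  ∑-shift : ∀ n f → ∑ (suc n) f ≡ f 0 + ∑ n (λ i → f (suc i))
  ∑-shift zero    f rewrite ∑-suc 0 f | ∑-zero f | ∑-zero (λ i → f (suc i)) = refl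
  ∑-shift (suc n) f
    rewrite ∑-suc (suc n) f | ∑-shift n f | ∑-suc n (λ i → f (suc i))
    = +-assoc (f 0) _ _

  ∑-zeros : ∀ n f → (∀ i → i ≤ n → f i ≡ 0#) → ∑ n f ≡ 0#
  ∑-zeros zero    f f≗0 = trans (∑-zero f) (f≗0 0 z≤n)
  ∑-zeros (suc n) f f≗0
    rewrite ∑-suc n f | ∑-zeros n f (λ i i≤n → f≗0 i (≤-trans i≤n (n≤1+n n))) | f≗0 (suc n) ≤-refl
    = +-identityˡ 0#

  ∑-single : ∀ n c f → c ≤ n → (∀ i → i ≤ n → i ≢ c → f i ≡ 0#) → ∑ n f ≡ f c
  ∑-single zero    zero    f _   f≗0 = ∑-zero f
  ∑-single (suc n) c       f c≤n f≗0 with c ≟ suc n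
  ... | yes refl
    rewrite ∑-suc n f | ∑-zeros n f (λ i i≤n → f≗0 i (≤-trans i≤n (n≤1+n n)) (λ { refl → <-irrefl refl (s≤s i≤n) }))
    = +-identityˡ (f (suc n))
  ... | no c≢1+n
    rewrite ∑-suc n f | f≗0 (suc n) ≤-refl (c≢1+n ∘ sym)
          | ∑-single n c f (≤-pred (≤∧≢⇒< c≤n c≢1+n)) (λ i i≤n → f≗0 i (≤-trans i≤n (n≤1+n n)))
    = +-identityʳ (f c)

  ∑-reverse : ∀ n f → ∑ n (λ i → f (n ∸ i)) ≡ ∑ n f
  ∑-reverse zero    f = trans (∑-zero _) (sym (∑-zero f))
  ∑-reverse (suc n) f = begin
    ∑ (suc n) (λ i → f (suc n ∸ i))     ≡⟨ ∑-shift n _ ⟩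
    f (suc n) + ∑ n (λ i → f (n ∸ i))   ≡⟨ cong (f (suc n) +_) (∑-reverse n f) ⟩
    f (suc n) + ∑ n f                   ≡⟨ +-comm (f (suc n)) _ ⟩
    ∑ n f + f (suc n)                   ≡⟨ ∑-suc n f ⟨
    ∑ (suc n) f                         ∎

module NatSums where

  open import Data.Nat using (_+_; _*_; _∸_; _≤_; _<_; _!; _≡ᵇ_; _≤?_; NonZero)
  open import Relation.Nullary using (yes; no)
  open import Function using (_∘_)
  open import Data.Nat.Properties
  open import Algebra.Properties.CommutativeSemigroup +-commutativeSemigroup using (x∙yz≈y∙xz)
  open import Data.Nat.Combinatorics using (_C_; nCk+nC[k+1]≡[n+1]C[k+1]; k>n⇒nCk≡0; nCk≡n!/k![n-k]!; k![n∸k]!∣n!)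
  open import Data.Nat.DivMod using (m/n*n≡m)
  open import Data.Nat.ListAction using (sum)
  open import Data.List using ([]; _∷_; map)
  open import Relation.Binary.PropositionalEquality
  open ≡-Reasoning

  sumToℕ : ℕ → (ℕ → ℕ) → ℕ
  sumToℕ zero    f = f 0
  sumToℕ (suc n) f = sumToℕ n f + f (suc n)

  open RangeSum +-*-isCommutativeSemiring sumToℕ (λ _ → refl) (λ _ _ → refl) public

  binomialSum : ℕ → (ℕ → ℕ → ℕ) → ℕ
  binomialSum n G = sumToℕ n (λ i → (n C i) * G i (n ∸ i))

  -- The term G 0 (suc n) + 0 is (n C 0) * G 0 (suc n) after normalisation.
  binomialSum-sucʳ : ∀ n (G : ℕ → ℕ → ℕ) → binomialSum n (λ a b → G a (suc b)) ≡
                     G 0 (suc n) + 0 + sumToℕ n (λ i → (n C suc i) * G (suc i) (n ∸ i))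
  binomialSum-sucʳ n G = begin
    binomialSum n (λ a b → G a (suc b))
      ≡⟨ ∑-cong n (λ i i≤n → cong (λ m → (n C i) * G i m) (+-∸-assoc 1 i≤n)) ⟨
    sumToℕ n (λ i → (n C i) * G i (suc n ∸ i))
      ≡⟨ +-identityʳ _ ⟨
    sumToℕ n (λ i → (n C i) * G i (suc n ∸ i)) + 0
      ≡⟨ cong (sumToℕ n (λ i → (n C i) * G i (suc n ∸ i)) +_)
              (cong (_* G (suc n) (n ∸ n)) (k>n⇒nCk≡0 (n<1+n n))) ⟨
    sumToℕ (suc n) (λ i → (n C i) * G i (suc n ∸ i))
      ≡⟨ ∑-shift n (λ i → (n C i) * G i (suc n ∸ i)) ⟩
    G 0 (suc n) + 0 + sumToℕ n (λ i → (n C suc i) * G (suc i) (n ∸ i)) ∎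

  binomialSum-suc : ∀ n (G : ℕ → ℕ → ℕ) → binomialSum (suc n) G ≡
                    binomialSum n (λ a b → G (suc a) b) + binomialSum n (λ a b → G a (suc b))
  binomialSum-suc n G = begin
    binomialSum (suc n) G
      ≡⟨ ∑-shift n (λ i → (suc n C i) * G i (suc n ∸ i)) ⟩
    G 0 (suc n) + 0 + sumToℕ n (λ i → (suc n C suc i) * G (suc i) (n ∸ i))
      ≡⟨ cong (G 0 (suc n) + 0 +_) pascal ⟩
    G 0 (suc n) + 0 + (left + upper)
      ≡⟨ x∙yz≈y∙xz (G 0 (suc n) + 0) left upper ⟩
    left + (G 0 (suc n) + 0 + upper)
      ≡⟨ cong (left +_) (binomialSum-sucʳ n G) ⟨
    left + binomialSum n (λ a b → G a (suc b)) ∎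
    where
    left upper : ℕ
    left  = binomialSum n (λ a b → G (suc a) b)
    upper = sumToℕ n (λ i → (n C suc i) * G (suc i) (n ∸ i))
    pascal : sumToℕ n (λ i → (suc n C suc i) * G (suc i) (n ∸ i)) ≡ left + upper
    pascal = trans (∑-cong n λ i _ → trans (cong (_* G (suc i) (n ∸ i)) (sym (nCk+nC[k+1]≡[n+1]C[k+1] n i)))
                                           (*-distribʳ-+ (G (suc i) (n ∸ i)) (n C i) (n C suc i)))
                   (∑-distrib-+ n (λ i → (n C i) * G (suc i) (n ∸ i)) (λ i → (n C suc i) * G (suc i) (n ∸ i)))

  nCk*k!*[n∸k]!≡n! : ∀ {n k} → k ≤ n → (n C k) * (k ! * (n ∸ k) !) ≡ n !
  nCk*k!*[n∸k]!≡n! {n} {k} k≤n = trans (cong (_* (k ! * (n ∸ k) !)) (nCk≡n!/k![n-k]! k≤n)) (m/n*n≡m (k![n∸k]!∣n! k≤n))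
    where
    instance
      k!*[n∸k]!≢0 : NonZero (k ! * (n ∸ k) !)
      k!*[n∸k]!≢0 = k !* (n ∸ k) !≢0

  sum-map-sumToℕ : ∀ {A : Set} j (F : A → ℕ → ℕ) xs →
                   sum (map (λ x → sumToℕ j (F x)) xs) ≡ sumToℕ j (λ u → sum (map (λ x → F x u) xs))
  sum-map-sumToℕ j F []       = sym (∑-zeros j (λ _ → 0) (λ _ _ → refl))
  sum-map-sumToℕ j F (x ∷ xs) =
    trans (cong (sumToℕ j (F x) +_) (sum-map-sumToℕ j F xs)) (sym (∑-distrib-+ j (F x) _))

  ∑-const : ∀ n c → sumToℕ n (λ _ → c) ≡ suc n * c
  ∑-const zero    c = sym (+-identityʳ c)
  ∑-const (suc n) c = trans (cong (_+ c) (∑-const n c)) (+-comm (suc n * c) c)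

  binomialSum-factorials : ∀ n → binomialSum n (λ a b → a ! * b !) ≡ suc n !
  binomialSum-factorials n = trans (∑-cong n (λ i i≤n → nCk*k!*[n∸k]!≡n! i≤n)) (∑-const n (n !))

  ∑-indicator : ∀ j (g : ℕ → ℕ) v → (j < v → g v ≡ 0) → sumToℕ j (λ u → ⟦ v ≡ᵇ u ⟧ * g u) ≡ g v
  ∑-indicator j g v vanish with v ≤? j
  ... | yes v≤j = begin
    sumToℕ j (λ u → ⟦ v ≡ᵇ u ⟧ * g u)
      ≡⟨ ∑-single j v (λ u → ⟦ v ≡ᵇ u ⟧ * g u) v≤j
                  (λ u _ u≢v → cong (λ b → ⟦ b ⟧ * g u) (≡ᵇ-false {v} {u} (u≢v ∘ sym))) ⟩
    ⟦ v ≡ᵇ v ⟧ * g v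
      ≡⟨ cong (λ b → ⟦ b ⟧ * g v) (≡ᵇ-true {v} refl) ⟩
    g v + 0
      ≡⟨ +-identityʳ (g v) ⟩
    g v ∎
  ... | no v≰j = begin
    sumToℕ j (λ u → ⟦ v ≡ᵇ u ⟧ * g u)
      ≡⟨ ∑-zeros j (λ u → ⟦ v ≡ᵇ u ⟧ * g u)
                 (λ u u≤j → cong (λ b → ⟦ b ⟧ * g u) (≡ᵇ-false {v} {u} λ { refl → v≰j u≤j })) ⟩
    0
      ≡⟨ vanish (≰⇒> v≰j) ⟨
    g v ∎

module Arrangements {A : Set} where

  open import Data.Nat using (_+_; _*_; _≤_; _!; s≤s)
  open import Data.Nat.Properties using (≤-trans; m≤m+n; m≤n+m; ≤-reflexive)
  open import Data.Nat.ListAction using (sum)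
  open import Data.List using (List; []; _∷_; _++_; length; map; concatMap)
  open import Data.List.Properties
    using (map-∘; length-++; length-map; ++-assoc; ∷-injective; ∷-injectiveˡ; ∷-injectiveʳ;
           ++-cancelˡ; ++-conicalˡ; ++-conicalʳ)
  open import Data.List.Relation.Unary.All as All using (All; []; _∷_)
  open import Data.List.Relation.Unary.AllPairs using (AllPairs; []; _∷_)
  open import Data.List.Relation.Unary.Any using (here; there)
  open import Data.List.Relation.Unary.Unique.Propositional using (Unique)
  import Data.List.Relation.Unary.Unique.Propositional.Properties as Unique
  open import Data.List.Membership.Propositional using (_∈_; _∉_; find; lose)
  open import Data.List.Membership.Propositional.Properties
    using (∈-++⁻; ∈-++⁺ˡ; ∈-++⁺ʳ; ∈-map⁻; ∈-map⁺; ∈-concatMap⁻; ∈-concatMap⁺; ∈-∃++)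
  open import Data.List.Relation.Binary.Permutation.Propositional
    using (_↭_; ↭-refl; ↭-sym; ↭-trans; ↭-prep)
  open import Data.List.Relation.Binary.Permutation.Propositional.Properties
    using (↭-length; ↭-empty-inv; shift; drop-mid; drop-∷; ∈-resp-↭; ++⁺)
  open import Data.Product using (∃; ∃₂; _×_; _,_; proj₁; proj₂; map₁; map₂)
  open import Data.Sum using (_⊎_; inj₁; inj₂)
  open import Data.Empty using (⊥; ⊥-elim)
  open import Function using (_∘_)
  open import Relation.Binary.PropositionalEquality
  open Lists using (concatMap-unique; sum-map-++; sum-map-concatMap; sum-map-cong; length-concatMap)
  open NatSums using (binomialSum; binomialSum-suc; binomialSum-factorials)

  splits : List A → List (List A × List A)
  splits []       = ([] , []) ∷ []
  splits (x ∷ xs) = map (map₁ (x ∷_)) (splits xs) ++ map (map₂ (x ∷_)) (splits xs)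

  ∈-splits⁻ : ∀ x xs {p} → p ∈ splits (x ∷ xs) →
              ∃ λ q → q ∈ splits xs × (p ≡ map₁ (x ∷_) q ⊎ p ≡ map₂ (x ∷_) q)
  ∈-splits⁻ x xs p∈ with ∈-++⁻ (map (map₁ (x ∷_)) (splits xs)) p∈
  ... | inj₁ p∈ˡ = let (q , q∈ , p≡) = ∈-map⁻ (map₁ (x ∷_)) p∈ˡ in q , q∈ , inj₁ p≡
  ... | inj₂ p∈ʳ = let (q , q∈ , p≡) = ∈-map⁻ (map₂ (x ∷_)) p∈ʳ in q , q∈ , inj₂ p≡

  splits-↭ : ∀ xs {p} → p ∈ splits xs → proj₁ p ++ proj₂ p ↭ xs
  splits-↭ []       (here refl) = ↭-refl
  splits-↭ (x ∷ xs) p∈ with ∈-splits⁻ x xs p∈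
  ... | (L , R) , q∈ , inj₁ refl = ↭-prep x (splits-↭ xs q∈)
  ... | (L , R) , q∈ , inj₂ refl = ↭-trans (shift x L R) (↭-prep x (splits-↭ xs q∈))

  splits-length : ∀ xs {p} → p ∈ splits xs → length (proj₁ p) + length (proj₂ p) ≡ length xs
  splits-length xs {L , R} p∈ = trans (sym (length-++ L)) (↭-length (splits-↭ xs p∈))

  splits-lengthˡ : ∀ xs {p} → p ∈ splits xs → length (proj₁ p) ≤ length xs
  splits-lengthˡ xs p∈ = ≤-trans (m≤m+n _ _) (≤-reflexive (splits-length xs p∈))

  splits-lengthʳ : ∀ xs {p} → p ∈ splits xs → length (proj₂ p) ≤ length xs
  splits-lengthʳ xs p∈ = ≤-trans (m≤n+m _ _) (≤-reflexive (splits-length xs p∈))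

  ∈-splits⁺ : ∀ xs {L R} → L ++ R ↭ xs → ∃ λ p → p ∈ splits xs × L ↭ proj₁ p × R ↭ proj₂ p
  ∈-splits⁺ [] {L} L++R↭[] with ++-conicalˡ L _ (↭-empty-inv L++R↭[]) | ++-conicalʳ L _ (↭-empty-inv L++R↭[])
  ... | refl | refl = ([] , []) , here refl , ↭-refl , ↭-refl
  ∈-splits⁺ (x ∷ xs) {L} {R} L++R↭ with ∈-++⁻ L (∈-resp-↭ (↭-sym L++R↭) (here refl))
  ... | inj₁ x∈L with ∈-∃++ x∈L
  ...   | L₁ , L₂ , refl
    with ∈-splits⁺ xs {L₁ ++ L₂} {R}
           (subst (_↭ xs) (sym (++-assoc L₁ L₂ R))
             (drop-mid L₁ [] (subst (_↭ x ∷ xs) (++-assoc L₁ (x ∷ L₂) R) L++R↭)))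
  ...     | (L′ , R′) , q∈ , L↭ , R↭ =
    (x ∷ L′ , R′) , ∈-++⁺ˡ (∈-map⁺ (map₁ (x ∷_)) q∈) , ↭-trans (shift x L₁ L₂) (↭-prep x L↭) , R↭
  ∈-splits⁺ (x ∷ xs) {L} {R} L++R↭ | inj₂ x∈R with ∈-∃++ x∈R
  ...   | R₁ , R₂ , refl
    with ∈-splits⁺ xs {L} {R₁ ++ R₂}
           (subst (_↭ xs) (++-assoc L R₁ R₂)
             (drop-mid (L ++ R₁) [] (subst (_↭ x ∷ xs) (sym (++-assoc L R₁ (x ∷ R₂))) L++R↭)))
  ...     | (L′ , R′) , q∈ , L↭ , R↭ =
    (L′ , x ∷ R′) , ∈-++⁺ʳ _ (∈-map⁺ (map₂ (x ∷_)) q∈) , L↭ , ↭-trans (shift x R₁ R₂) (↭-prep x R↭)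

  splits-⊆ˡ : ∀ xs {p y} → p ∈ splits xs → y ∈ proj₁ p → y ∈ xs
  splits-⊆ˡ xs p∈ y∈ = ∈-resp-↭ (splits-↭ xs p∈) (∈-++⁺ˡ y∈)

  splits-⊆ʳ : ∀ xs {p y} → p ∈ splits xs → y ∈ proj₂ p → y ∈ xs
  splits-⊆ʳ xs {L , _} p∈ y∈ = ∈-resp-↭ (splits-↭ xs p∈) (∈-++⁺ʳ L y∈)

  splits-AllPairs : ∀ {R : A → A → Set} {xs p} → AllPairs R xs → p ∈ splits xs →
                    AllPairs R (proj₁ p) × AllPairs R (proj₂ p)
  splits-AllPairs {xs = []} _ (here refl) = [] , []
  splits-AllPairs {xs = x ∷ xs} (Rx ∷ Rxs) p∈ with ∈-splits⁻ x xs p∈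
  ... | _ , q∈ , inj₁ refl with splits-AllPairs Rxs q∈
  ...   | RL , RR = All.tabulate (All.lookup Rx ∘ splits-⊆ˡ xs q∈) ∷ RL , RR
  splits-AllPairs {xs = x ∷ xs} (Rx ∷ Rxs) p∈ | _ , q∈ , inj₂ refl with splits-AllPairs Rxs q∈
  ...   | RL , RR = RL , All.tabulate (All.lookup Rx ∘ splits-⊆ʳ xs q∈) ∷ RR

  splits-unique : ∀ {xs} → Unique xs → Unique (splits xs)
  splits-unique {[]}     _            = [] ∷ []
  splits-unique {x ∷ xs} (x∉xs ∷ uxs) =
    Unique.++⁺ (Unique.map⁺ (λ { {_ , _} {_ , _} refl → refl }) (splits-unique uxs))
               (Unique.map⁺ (λ { {_ , _} {_ , _} refl → refl }) (splits-unique uxs))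
               disjoint
    where
    disjoint : ∀ {p} → p ∈ map (map₁ (x ∷_)) (splits xs) × p ∈ map (map₂ (x ∷_)) (splits xs) → ⊥
    disjoint (p∈ˡ , p∈ʳ) with ∈-map⁻ (map₁ (x ∷_)) p∈ˡ | ∈-map⁻ (map₂ (x ∷_)) p∈ʳ
    ... | _ , _ , refl | _ , q∈ , eq =
      All.lookup x∉xs (splits-⊆ˡ xs q∈ (subst (x ∈_) (cong proj₁ eq) (here refl))) refl

  splits-injective : ∀ {xs p q} → Unique xs → p ∈ splits xs → q ∈ splits xs → proj₁ p ↭ proj₁ q → p ≡ q
  splits-injective {[]} _ (here refl) (here refl) _ = refl
  splits-injective {x ∷ xs} (x∉xs ∷ uxs) p∈ q∈ L↭L′ with ∈-splits⁻ x xs p∈ | ∈-splits⁻ x xs q∈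
  ... | _ , p′∈ , inj₁ refl | _ , q′∈ , inj₁ refl = cong (map₁ (x ∷_)) (splits-injective uxs p′∈ q′∈ (drop-∷ L↭L′))
  ... | _ , p′∈ , inj₂ refl | _ , q′∈ , inj₂ refl = cong (map₂ (x ∷_)) (splits-injective uxs p′∈ q′∈ L↭L′)
  ... | _ , p′∈ , inj₁ refl | _ , q′∈ , inj₂ refl =
    ⊥-elim (All.lookup x∉xs (splits-⊆ˡ xs q′∈ (∈-resp-↭ L↭L′ (here refl))) refl)
  ... | _ , p′∈ , inj₂ refl | _ , q′∈ , inj₁ refl =
    ⊥-elim (All.lookup x∉xs (splits-⊆ˡ xs p′∈ (∈-resp-↭ (↭-sym L↭L′) (here refl))) refl)

  ++-∷-injective : ∀ {m : A} (σ σ′ : List A) {τ τ′} → m ∉ σ → m ∉ σ′ → σ ++ m ∷ τ ≡ σ′ ++ m ∷ τ′ → σ ≡ σ′ × τ ≡ τ′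
  ++-∷-injective []      []       _    _     eq = refl , ∷-injectiveʳ eq
  ++-∷-injective []      (_ ∷ _)  _    m∉σ′  eq = ⊥-elim (m∉σ′ (here (∷-injectiveˡ eq)))
  ++-∷-injective (_ ∷ _) []       m∉σ  _     eq = ⊥-elim (m∉σ (here (sym (∷-injectiveˡ eq))))
  ++-∷-injective (x ∷ σ) (y ∷ σ′) m∉xσ m∉yσ′ eq with ∷-injective eq
  ... | refl , eq′ with ++-∷-injective σ σ′ (m∉xσ ∘ there) (m∉yσ′ ∘ there) eq′
  ...   | refl , refl = refl , refl

  glue : A → List (List A) → List (List A) → List (List A)
  glue m Σ T = concatMap (λ σ → map (λ τ → σ ++ m ∷ τ) T) Σ

  ∈-glue⁻ : ∀ m Σ T {w} → w ∈ glue m Σ T → ∃₂ λ σ τ → σ ∈ Σ × τ ∈ T × w ≡ σ ++ m ∷ τ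
  ∈-glue⁻ m Σ T w∈ with find (∈-concatMap⁻ (λ σ → map (λ τ → σ ++ m ∷ τ) T) {xs = Σ} w∈)
  ... | σ , σ∈ , w∈′ with ∈-map⁻ (λ τ → σ ++ m ∷ τ) w∈′
  ...   | τ , τ∈ , w≡ = σ , τ , σ∈ , τ∈ , w≡

  ∈-glue⁺ : ∀ {m Σ T σ τ} → σ ∈ Σ → τ ∈ T → σ ++ m ∷ τ ∈ glue m Σ T
  ∈-glue⁺ {m} {T = T} σ∈ τ∈ = ∈-concatMap⁺ (λ σ → map (λ τ → σ ++ m ∷ τ) T) (lose σ∈ (∈-map⁺ _ τ∈))

  glue-unique : ∀ {m Σ T} → Unique Σ → Unique T → (∀ {σ} → σ ∈ Σ → m ∉ σ) → Unique (glue m Σ T)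
  glue-unique {m} {Σ} {T} uΣ uT m∉ =
    concatMap-unique _ uΣ (λ {σ} _ → Unique.map⁺ (∷-injectiveʳ ∘ ++-cancelˡ σ _ _) uT) same-σ
    where
    same-σ : ∀ {σ σ′ w} → σ ∈ Σ → σ′ ∈ Σ → w ∈ map (λ τ → σ ++ m ∷ τ) T → w ∈ map (λ τ → σ′ ++ m ∷ τ) T → σ ≡ σ′
    same-σ {σ} {σ′} σ∈ σ′∈ w∈ w∈′ with ∈-map⁻ (λ τ → σ ++ m ∷ τ) w∈ | ∈-map⁻ (λ τ → σ′ ++ m ∷ τ) w∈′
    ... | _ , _ , refl | _ , _ , eq = proj₁ (++-∷-injective σ σ′ (m∉ σ∈) (m∉ σ′∈) eq)

  -- The orderings of S, obtained by putting the head of S between orderings of complementary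
  -- sublists of its tail; the fuel f is sufficient once length S ≤ f.
  arrangements : ℕ → List A → List (List A)
  arrangements zero    _       = [] ∷ []
  arrangements (suc f) []      = [] ∷ []
  arrangements (suc f) (m ∷ S) = concatMap (λ (L , R) → glue m (arrangements f L) (arrangements f R)) (splits S)

  ∈-arrangements⁻ : ∀ f m S {w} → w ∈ arrangements (suc f) (m ∷ S) →
                    ∃ λ p → p ∈ splits S × w ∈ glue m (arrangements f (proj₁ p)) (arrangements f (proj₂ p))
  ∈-arrangements⁻ f m S w∈ = find (∈-concatMap⁻ _ {xs = splits S} w∈)

  arrangements-↭ : ∀ f S {w} → length S ≤ f → w ∈ arrangements f S → w ↭ S
  arrangements-↭ zero    []      _         (here refl) = ↭-refl
  arrangements-↭ (suc f) []      _         (here refl) = ↭-refl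
  arrangements-↭ (suc f) (m ∷ S) (s≤s S≤f) w∈ with ∈-arrangements⁻ f m S w∈
  ... | (L , R) , p∈ , w∈′ with ∈-glue⁻ m _ _ w∈′
  ...   | σ , τ , σ∈ , τ∈ , refl =
    ↭-trans (shift m σ τ)
      (↭-prep m (↭-trans (++⁺ (arrangements-↭ f L (≤-trans (splits-lengthˡ S p∈) S≤f) σ∈)
                              (arrangements-↭ f R (≤-trans (splits-lengthʳ S p∈) S≤f) τ∈))
                         (splits-↭ S p∈)))

  ∈-arrangements⁺ : ∀ f S {w} → length S ≤ f → w ↭ S → w ∈ arrangements f S
  ∈-arrangements⁺ zero    []      _         w↭ rewrite ↭-empty-inv w↭ = here refl
  ∈-arrangements⁺ (suc f) []      _         w↭ rewrite ↭-empty-inv w↭ = here refl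
  ∈-arrangements⁺ (suc f) (m ∷ S) (s≤s S≤f) w↭ with ∈-∃++ (∈-resp-↭ (↭-sym w↭) (here refl))
  ... | σ , τ , refl with ∈-splits⁺ S (drop-mid σ [] w↭)
  ...   | (L , R) , p∈ , σ↭L , τ↭R =
    ∈-concatMap⁺ _ (lose p∈ (∈-glue⁺ (∈-arrangements⁺ f L (≤-trans (splits-lengthˡ S p∈) S≤f) σ↭L)
                                     (∈-arrangements⁺ f R (≤-trans (splits-lengthʳ S p∈) S≤f) τ↭R)))

  arrangements-unique : ∀ f {S} → length S ≤ f → Unique S → Unique (arrangements f S)
  arrangements-unique zero    {[]}    _         _            = [] ∷ []
  arrangements-unique (suc f) {[]}    _         _            = [] ∷ []
  arrangements-unique (suc f) {m ∷ S} (s≤s S≤f) (m∉S ∷ uS) =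
    concatMap-unique _ (splits-unique uS)
      (λ p∈ → glue-unique (arrangements-unique f (≤-trans (splits-lengthˡ S p∈) S≤f) (proj₁ (splits-AllPairs uS p∈)))
                          (arrangements-unique f (≤-trans (splits-lengthʳ S p∈) S≤f) (proj₂ (splits-AllPairs uS p∈)))
                          (m∉ p∈))
      same-split
    where
    σ↭ : ∀ {p σ} → p ∈ splits S → σ ∈ arrangements f (proj₁ p) → σ ↭ proj₁ p
    σ↭ {L , _} p∈ = arrangements-↭ f L (≤-trans (splits-lengthˡ S p∈) S≤f)

    m∉ : ∀ {p σ} → p ∈ splits S → σ ∈ arrangements f (proj₁ p) → m ∉ σ
    m∉ p∈ σ∈ m∈σ = All.lookup m∉S (splits-⊆ˡ S p∈ (∈-resp-↭ (σ↭ p∈ σ∈) m∈σ)) refl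

    same-split : ∀ {p q w} → p ∈ splits S → q ∈ splits S →
                 w ∈ glue m (arrangements f (proj₁ p)) (arrangements f (proj₂ p)) →
                 w ∈ glue m (arrangements f (proj₁ q)) (arrangements f (proj₂ q)) → p ≡ q
    same-split p∈ q∈ w∈ w∈′ with ∈-glue⁻ m _ _ w∈ | ∈-glue⁻ m _ _ w∈′
    ... | σ , _ , σ∈ , _ , refl | σ′ , _ , σ′∈ , _ , eq with ++-∷-injective σ σ′ (m∉ p∈ σ∈) (m∉ q∈ σ′∈) eq
    ...   | refl , _ = splits-injective uS p∈ q∈ (↭-trans (↭-sym (σ↭ p∈ σ∈)) (σ↭ q∈ σ′∈))

  sum-map-glue : ∀ (g : List A → ℕ) m Σ T →
                 sum (map g (glue m Σ T)) ≡ sum (map (λ σ → sum (map (λ τ → g (σ ++ m ∷ τ)) T)) Σ)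
  sum-map-glue g m Σ T =
    trans (sum-map-concatMap g _ Σ) (sum-map-cong Σ (λ {σ} _ → cong sum (sym (map-∘ T))))

  splits-count : ∀ (S : List A) G →
    sum (map (λ p → G (length (proj₁ p)) (length (proj₂ p))) (splits S)) ≡ binomialSum (length S) G
  splits-count []       G = refl
  splits-count (x ∷ S) G = begin
    sum (map g (map (map₁ (x ∷_)) (splits S) ++ map (map₂ (x ∷_)) (splits S)))
      ≡⟨ sum-map-++ g (map (map₁ (x ∷_)) (splits S)) _ ⟩
    sum (map g (map (map₁ (x ∷_)) (splits S))) + sum (map g (map (map₂ (x ∷_)) (splits S)))
      ≡⟨ cong₂ _+_ (cong sum (sym (map-∘ (splits S)))) (cong sum (sym (map-∘ (splits S)))) ⟩
    sum (map (λ p → G (suc (length (proj₁ p))) (length (proj₂ p))) (splits S)) +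
    sum (map (λ p → G (length (proj₁ p)) (suc (length (proj₂ p)))) (splits S))
      ≡⟨ cong₂ _+_ (splits-count S (λ a b → G (suc a) b)) (splits-count S (λ a b → G a (suc b))) ⟩
    binomialSum (length S) (λ a b → G (suc a) b) + binomialSum (length S) (λ a b → G a (suc b))
      ≡⟨ binomialSum-suc (length S) G ⟨
    binomialSum (suc (length S)) G ∎
    where
    open ≡-Reasoning
    g : List A × List A → ℕ
    g p = G (length (proj₁ p)) (length (proj₂ p))

  length-glue : ∀ m Σ T → length (glue m Σ T) ≡ length Σ * length T
  length-glue m []      T = refl
  length-glue m (σ ∷ Σ) T = trans (length-++ (map (λ τ → σ ++ m ∷ τ) T))
                                  (cong₂ _+_ (length-map (λ τ → σ ++ m ∷ τ) T) (length-glue m Σ T))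

  length-arrangements : ∀ f S → length S ≤ f → length (arrangements f S) ≡ length S !
  length-arrangements zero    []      _         = refl
  length-arrangements (suc f) []      _         = refl
  length-arrangements (suc f) (m ∷ S) (s≤s S≤f) = begin
    length (arrangements (suc f) (m ∷ S))
      ≡⟨ length-concatMap _ (splits S) ⟩
    sum (map (λ p → length (glue m (arrangements f (proj₁ p)) (arrangements f (proj₂ p)))) (splits S))
      ≡⟨ sum-map-cong (splits S) (λ {p} p∈ → trans (length-glue m (arrangements f (proj₁ p)) _) (cong₂ _*_
           (length-arrangements f (proj₁ p) (≤-trans (splits-lengthˡ S p∈) S≤f))
           (length-arrangements f (proj₂ p) (≤-trans (splits-lengthʳ S p∈) S≤f)))) ⟩
    sum (map (λ p → length (proj₁ p) ! * length (proj₂ p) !) (splits S))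
      ≡⟨ splits-count S (λ a b → a ! * b !) ⟩
    binomialSum (length S) (λ a b → a ! * b !)
      ≡⟨ binomialSum-factorials (length S) ⟩
    suc (length S) ! ∎
    where open ≡-Reasoning

module Permutations where

  open import Data.Nat using (_≤_; _<_; s≤s; z≤n; _≟_)
  open import Data.Nat.Properties using (<⇒≢; ≤-trans; ≤-reflexive; <-irrefl)
  open import Data.List using (List; []; _∷_; _++_; length; map; upTo)
  open import Data.List.Properties using (length-map; length-upTo; map-applyUpTo; ∷-injectiveˡ; ∷-injectiveʳ)
  open import Data.List.Relation.Unary.All as All using (All; []; _∷_)
  open import Data.List.Relation.Unary.AllPairs as AllPairs using (AllPairs; []; _∷_)
  import Data.List.Relation.Unary.AllPairs.Properties as AllPairs
  open import Data.List.Relation.Unary.Any using (here; there)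
  open import Data.List.Relation.Unary.Unique.Propositional using (Unique)
  import Data.List.Relation.Unary.Unique.Propositional.Properties as Unique
  open import Data.List.Relation.Unary.Unique.DecPropositional _≟_ using (unique?)
  open import Data.List.Membership.Propositional using (_∈_; find; lose)
  open import Data.List.Membership.Propositional.Properties
    using (∈-map⁻; ∈-map⁺; ∈-concatMap⁻; ∈-concatMap⁺; ∈-filter⁻; ∈-filter⁺; ∈-∃++; ∈-++⁻; ∈-++⁺ˡ; ∈-++⁺ʳ)
  open import Data.List.Membership.DecPropositional _≟_ using (_∈?_)
  open import Data.List.Relation.Binary.Subset.Propositional using (_⊆_)
  open import Data.List.Relation.Binary.Permutation.Propositional using (_↭_; ↭-sym; ↭⇒↭ₛ)
  open import Data.List.Relation.Binary.Permutation.Propositional.Properties using (↭-length; ∈-resp-↭; shift)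
  open import Relation.Binary.PropositionalEquality
  open import Data.List.Relation.Binary.Permutation.Setoid.Properties (setoid ℕ) using (Unique-resp-↭)
  open import Data.Product using (_×_; _,_)
  open import Data.Sum using (inj₁; inj₂)
  open import Data.Empty using (⊥-elim)
  open import Function using (id; _∘_)
  open import Relation.Nullary using (yes; no)
  open Lists using (concatMap-unique; unique-⊆-⊇⇒↭)
  open Arrangements using (arrangements; arrangements-unique; arrangements-↭; ∈-arrangements⁺)

  -- {1, …, n}, written exactly as the alphabet of words in Defs.
  letters : ℕ → List ℕ
  letters n = map suc (upTo n)

  letters-sorted : ∀ n → AllPairs _<_ (letters n)
  letters-sorted n = subst (AllPairs _<_) (sym (map-applyUpTo id suc n))
                       (AllPairs.applyUpTo⁺₁ suc n (λ i<j _ → s≤s i<j))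

  letters-unique : ∀ n → Unique (letters n)
  letters-unique n = AllPairs.map <⇒≢ (letters-sorted n)

  length-letters : ∀ n → length (letters n) ≡ n
  length-letters n = trans (length-map suc (upTo n)) (length-upTo n)

  ∈-words⁻ : ∀ l m {w} → w ∈ words l m → length w ≡ l × All (_∈ letters m) w
  ∈-words⁻ zero    m (here refl) = refl , []
  ∈-words⁻ (suc l) m w∈ with find (∈-concatMap⁻ (λ a → map (a ∷_) (words l m)) {xs = letters m} w∈)
  ... | a , a∈ , w∈′ with ∈-map⁻ (a ∷_) w∈′
  ...   | w′ , w′∈ , refl with ∈-words⁻ l m w′∈
  ...     | refl , w′⊆ = refl , a∈ ∷ w′⊆

  ∈-words⁺ : ∀ m {w} → All (_∈ letters m) w → w ∈ words (length w) m
  ∈-words⁺ m []        = here refl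
  ∈-words⁺ m (a∈ ∷ w⊆) = ∈-concatMap⁺ _ (lose a∈ (∈-map⁺ _ (∈-words⁺ m w⊆)))

  words-unique : ∀ l m → Unique (words l m)
  words-unique zero    m = [] ∷ []
  words-unique (suc l) m =
    concatMap-unique (λ a → map (a ∷_) (words l m)) (letters-unique m)
      (λ _ → Unique.map⁺ ∷-injectiveʳ (words-unique l m))
      (λ {a} {b} _ _ w∈ w∈′ → let (_ , _ , eq) = ∈-map⁻ (a ∷_) w∈ ; (_ , _ , eq′) = ∈-map⁻ (b ∷_) w∈′
                              in ∷-injectiveˡ (trans (sym eq) eq′))

  perms-unique : ∀ n → Unique (perms n)
  perms-unique n = Unique.filter⁺ unique? (words-unique n n)

  length-≤-⊆ : ∀ {xs ys : List ℕ} → Unique xs → xs ⊆ ys → length xs ≤ length ys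
  length-≤-⊆ {[]}     _            _     = z≤n
  length-≤-⊆ {x ∷ xs} (x∉xs ∷ uxs) x∷xs⊆ys with ∈-∃++ (x∷xs⊆ys (here refl))
  ... | ys₁ , ys₂ , refl = ≤-trans (s≤s (length-≤-⊆ uxs xs⊆)) (≤-reflexive (sym (↭-length (shift x ys₁ ys₂))))
    where
    xs⊆ : xs ⊆ ys₁ ++ ys₂
    xs⊆ y∈ with ∈-++⁻ ys₁ (x∷xs⊆ys (there y∈))
    ... | inj₁ y∈₁         = ∈-++⁺ˡ y∈₁
    ... | inj₂ (here refl) = ⊥-elim (All.lookup x∉xs y∈ refl)
    ... | inj₂ (there y∈₂) = ∈-++⁺ʳ ys₁ y∈₂

  ⊆-pigeonhole : ∀ {xs ys : List ℕ} → Unique xs → xs ⊆ ys → length ys ≤ length xs → ys ⊆ xs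
  ⊆-pigeonhole {xs} {ys} uxs xs⊆ys ys≤xs {y} y∈ys with y ∈? xs
  ... | yes y∈xs = y∈xs
  ... | no  y∉xs = ⊥-elim (<-irrefl refl (≤-trans (length-≤-⊆ (y∉ ∷ uxs) y∷xs⊆ys) ys≤xs))
    where
    y∉ : All (y ≢_) xs
    y∉ = All.tabulate λ x∈ y≡x → y∉xs (subst (_∈ xs) (sym y≡x) x∈)
    y∷xs⊆ys : y ∷ xs ⊆ ys
    y∷xs⊆ys (here refl) = y∈ys
    y∷xs⊆ys (there x∈)  = xs⊆ys x∈

  ∈-perms⁻ : ∀ n {w} → w ∈ perms n → w ↭ letters n
  ∈-perms⁻ n w∈ with ∈-filter⁻ unique? {xs = words n n} w∈
  ... | w∈words , uw with ∈-words⁻ n n w∈words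
  ...   | |w|≡n , w⊆ =
    unique-⊆-⊇⇒↭ uw (letters-unique n) (All.lookup w⊆)
      (⊆-pigeonhole uw (All.lookup w⊆) (≤-reflexive (trans (length-letters n) (sym |w|≡n))))

  ∈-perms⁺ : ∀ n {w} → w ↭ letters n → w ∈ perms n
  ∈-perms⁺ n {w} w↭ =
    ∈-filter⁺ unique?
      (subst (λ l → w ∈ words l n) (trans (↭-length w↭) (length-letters n))
             (∈-words⁺ n (All.tabulate (∈-resp-↭ w↭))))
      (Unique-resp-↭ (↭⇒↭ₛ (↭-sym w↭)) (letters-unique n))

  perms-↭-arrangements : ∀ n → perms n ↭ arrangements n (letters n)
  perms-↭-arrangements n =
    unique-⊆-⊇⇒↭ (perms-unique n) (arrangements-unique n fuel (letters-unique n))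
      (∈-arrangements⁺ n (letters n) fuel ∘ ∈-perms⁻ n)
      (∈-perms⁺ n ∘ arrangements-↭ n (letters n) fuel)
    where
    fuel : length (letters n) ≤ n
    fuel = ≤-reflexive (length-letters n)

module Counting (k l : ℕ) where

  open import Data.Bool using (true; false; if_then_else_)
  open import Data.Nat using (_+_; _*_; _∸_; _≤_; _<_; _!; _≤ᵇ_; _≡ᵇ_; _≟_; s≤s)
  open import Data.Nat.Properties
  open import Data.Nat.ListAction using (sum)
  open import Data.List using (List; []; _∷_; _++_; length; map)
  open import Data.List.Relation.Unary.All as All using (All; []; _∷_)
  open import Data.List.Relation.Unary.AllPairs using (AllPairs; []; _∷_)
  open import Data.List.Membership.Propositional using (_∈_)
  open import Data.List.Relation.Binary.Permutation.Propositional using (_↭_; ↭-sym)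
  open import Data.List.Relation.Binary.Permutation.Propositional.Properties using (↭-length; All-resp-↭)
  open import Data.Product using (_,_; proj₁; proj₂)
  open import Function using (_∘_)
  open import Relation.Binary.PropositionalEquality
  open ≡-Reasoning
  open Occurrences using (occ-split; centred; occursAtStart-short)
  open Lists
  open Arrangements
  open Permutations
  open NatSums
  open import Data.Nat.Combinatorics using (_C_)
  open import Algebra.Properties.CommutativeSemigroup +-commutativeSemigroup using (xy∙z≈xz∙y)

  weight : (ℕ → ℕ) → List (List ℕ) → ℕ
  weight h W = sum (map (h ∘ occ k l) W)

  permSum : ℕ → (ℕ → ℕ) → ℕ
  permSum n h = weight h (perms n)

  count≡permSum : ∀ n j → count k l n j ≡ permSum n (λ v → ⟦ v ≡ᵇ j ⟧)
  count≡permSum n j = length-filter (λ π → occ k l π ≟ j) (perms n)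

  binomialPermSum : ℕ → (ℕ → ℕ) → ℕ
  binomialPermSum n h = binomialSum n (λ a b → permSum a (λ u → permSum b (λ v → h (u + v + centred k l a b))))

  occ-around-min : ∀ {m σ τ L R} → All (m <_) L → All (m <_) R → σ ↭ L → τ ↭ R →
                   occ k l (σ ++ m ∷ τ) ≡ occ k l σ + occ k l τ + centred k l (length L) (length R)
  occ-around-min {σ = σ} {τ} m<L m<R σ↭L τ↭R =
    trans (occ-split k l σ (All-resp-↭ (↭-sym σ↭L) m<L) (All-resp-↭ (↭-sym τ↭R) m<R))
          (cong₂ (λ a b → occ k l σ + occ k l τ + centred k l a b) (↭-length σ↭L) (↭-length τ↭R))

  -- Occurrences only see the relative order of letters, so the weight of the arrangements of an
  -- increasing list depends only on its length. This is proved by induction on the length,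
  -- together with the recurrence for permSum.
  Standardised : ℕ → Set
  Standardised n = ∀ {S} f h → AllPairs _<_ S → length S ≤ n → length S ≤ f →
                   weight h (arrangements f S) ≡ permSum (length S) h

  weight-arrangements-∷ : ∀ {m S} f h → Standardised (length S) → AllPairs _<_ (m ∷ S) → length S ≤ f →
                          weight h (arrangements (suc f) (m ∷ S)) ≡ binomialPermSum (length S) h
  weight-arrangements-∷ {m} {S} f h standardised (m<S ∷ sorted) S≤f = begin
    weight h (arrangements (suc f) (m ∷ S))
      ≡⟨ sum-map-concatMap (h ∘ occ k l) _ (splits S) ⟩
    sum (map (λ p → weight h (glue m (arrangements f (proj₁ p)) (arrangements f (proj₂ p)))) (splits S))
      ≡⟨ sum-map-cong (splits S) split-term ⟩
    sum (map (λ p → G (length (proj₁ p)) (length (proj₂ p))) (splits S))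
      ≡⟨ splits-count S G ⟩
    binomialPermSum (length S) h ∎
    where
    G : ℕ → ℕ → ℕ
    G a b = permSum a (λ u → permSum b (λ v → h (u + v + centred k l a b)))

    split-term : ∀ {p} → p ∈ splits S →
                 weight h (glue m (arrangements f (proj₁ p)) (arrangements f (proj₂ p))) ≡
                 G (length (proj₁ p)) (length (proj₂ p))
    split-term {L , R} p∈ = begin
      weight h (glue m (arrangements f L) (arrangements f R))
        ≡⟨ sum-map-glue (h ∘ occ k l) m (arrangements f L) _ ⟩
      sum (map (λ σ → sum (map (λ τ → h (occ k l (σ ++ m ∷ τ))) (arrangements f R))) (arrangements f L))
        ≡⟨ sum-map-cong (arrangements f L) (λ σ∈ → sum-map-cong (arrangements f R) (λ τ∈ →
             cong h (occ-around-min m<L m<R (arrangements-↭ f L L≤f σ∈) (arrangements-↭ f R R≤f τ∈)))) ⟩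
      weight (λ u → weight (λ v → h (u + v + δ)) (arrangements f R)) (arrangements f L)
        ≡⟨ sum-map-cong (arrangements f L) (λ {σ} _ →
             standardised f (λ v → h (occ k l σ + v + δ)) (proj₂ (splits-AllPairs sorted p∈)) R≤S R≤f) ⟩
      weight (λ u → permSum (length R) (λ v → h (u + v + δ))) (arrangements f L)
        ≡⟨ standardised f (λ u → permSum (length R) (λ v → h (u + v + δ))) (proj₁ (splits-AllPairs sorted p∈)) L≤S L≤f ⟩
      G (length L) (length R) ∎
      where
      δ : ℕ
      δ = centred k l (length L) (length R)
      L≤S : length L ≤ length S
      L≤S = splits-lengthˡ S p∈
      R≤S : length R ≤ length S
      R≤S = splits-lengthʳ S p∈
      L≤f : length L ≤ f
      L≤f = ≤-trans L≤S S≤f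
      R≤f : length R ≤ f
      R≤f = ≤-trans R≤S S≤f
      m<L : All (m <_) L
      m<L = All.tabulate (All.lookup m<S ∘ splits-⊆ˡ S p∈)
      m<R : All (m <_) R
      m<R = All.tabulate (All.lookup m<S ∘ splits-⊆ʳ S p∈)

  standardised⇒permSum-suc : ∀ n → Standardised n → ∀ h → permSum (suc n) h ≡ binomialPermSum n h
  standardised⇒permSum-suc n standardisedₙ h = begin
    permSum (suc n) h
      ≡⟨ sum-map-↭ (h ∘ occ k l) (perms-↭-arrangements (suc n)) ⟩
    weight h (arrangements (suc n) (1 ∷ rest))
      ≡⟨ weight-arrangements-∷ n h (subst Standardised (sym |rest|≡n) standardisedₙ)
                                   (letters-sorted (suc n)) (≤-reflexive |rest|≡n) ⟩
    binomialPermSum (length rest) h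
      ≡⟨ cong (λ m → binomialPermSum m h) |rest|≡n ⟩
    binomialPermSum n h ∎
    where
    rest : List ℕ
    rest = map suc (Data.List.applyUpTo suc n)
    |rest|≡n : length rest ≡ n
    |rest|≡n = suc-injective (length-letters (suc n))

  standardised : ∀ n → Standardised n
  standardised n       {[]}    zero    h _      _         _         = refl
  standardised n       {[]}    (suc f) h _      _         _         = refl
  standardised (suc n) {m ∷ S} (suc f) h sorted (s≤s S≤n) (s≤s S≤f) =
    trans (weight-arrangements-∷ f h standardisedS sorted S≤f)
          (sym (standardised⇒permSum-suc (length S) standardisedS h))
    where
    standardisedS : Standardised (length S)
    standardisedS f h sorted S′≤S = standardised n f h sorted (≤-trans S′≤S S≤n)

  permSum-suc : ∀ n h → permSum (suc n) h ≡ binomialPermSum n h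
  permSum-suc n = standardised⇒permSum-suc n (standardised n)

  occ-short : ∀ w → length w ≤ k + l → occ k l w ≡ 0
  occ-short []      _  = refl
  occ-short (x ∷ w) w≤ rewrite occursAtStart-short k l (x ∷ w) w≤ = occ-short w (≤-trans (n≤1+n _) w≤)

  length-perms : ∀ n → length (perms n) ≡ n !
  length-perms n = begin
    length (perms n)                         ≡⟨ ↭-length (perms-↭-arrangements n) ⟩
    length (arrangements n (letters n))      ≡⟨ length-arrangements n (letters n) (≤-reflexive (length-letters n)) ⟩
    length (letters n) !                     ≡⟨ cong _! (length-letters n) ⟩
    n !                                      ∎

  count-small : ∀ n j → n ≤ k + l → count k l n j ≡ ⟦ 0 ≡ᵇ j ⟧ * n !
  count-small n j n≤k+l = begin
    count k l n j
      ≡⟨ count≡permSum n j ⟩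
    permSum n (λ v → ⟦ v ≡ᵇ j ⟧)
      ≡⟨ sum-map-cong (perms n) (λ {π} π∈ → cong (λ v → ⟦ v ≡ᵇ j ⟧) (occ-short π (π≤ π∈))) ⟩
    sum (map (λ _ → ⟦ 0 ≡ᵇ j ⟧) (perms n))
      ≡⟨ sum-map-const ⟦ 0 ≡ᵇ j ⟧ (perms n) ⟩
    length (perms n) * ⟦ 0 ≡ᵇ j ⟧
      ≡⟨ cong (_* ⟦ 0 ≡ᵇ j ⟧) (length-perms n) ⟩
    n ! * ⟦ 0 ≡ᵇ j ⟧
      ≡⟨ *-comm (n !) _ ⟩
    ⟦ 0 ≡ᵇ j ⟧ * n ! ∎
    where
    π≤ : ∀ {π} → π ∈ perms n → length π ≤ k + l
    π≤ π∈ = ≤-trans (≤-reflexive (trans (↭-length (∈-perms⁻ n π∈)) (length-letters n))) n≤k+l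

  permSum-expand : ∀ n j (g : ℕ → ℕ) → (∀ u → j < u → g u ≡ 0) → permSum n g ≡ sumToℕ j (λ u → count k l n u * g u)
  permSum-expand n j g vanish = begin
    permSum n g
      ≡⟨ sum-map-cong (perms n) (λ {π} _ → sym (∑-indicator j g (occ k l π) (vanish _))) ⟩
    sum (map (λ π → sumToℕ j (λ u → ⟦ occ k l π ≡ᵇ u ⟧ * g u)) (perms n))
      ≡⟨ sum-map-sumToℕ j (λ π u → ⟦ occ k l π ≡ᵇ u ⟧ * g u) (perms n) ⟩
    sumToℕ j (λ u → sum (map (λ π → ⟦ occ k l π ≡ᵇ u ⟧ * g u) (perms n)))
      ≡⟨ ∑-cong j (λ u _ → trans (sum-map-*ʳ (λ π → ⟦ occ k l π ≡ᵇ u ⟧) (g u) (perms n))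
                                 (cong (_* g u) (sym (count≡permSum n u)))) ⟩
    sumToℕ j (λ u → count k l n u * g u) ∎

  shiftedCount : ℕ → ℕ → ℕ → ℕ
  shiftedCount m d t = if d ≤ᵇ t then count k l m (t ∸ d) else 0

  permSum-shifted : ∀ m s j → permSum m (λ v → ⟦ s + v ≡ᵇ j ⟧) ≡ shiftedCount m s j
  permSum-shifted m s j = trans (sum-map-cong (perms m) (λ {π} _ → ⟦+≡ᵇ⟧ s (occ k l π) j)) (by-cases (s ≤ᵇ j))
    where
    by-cases : ∀ b → sum (map (λ π → if b then ⟦ occ k l π ≡ᵇ j ∸ s ⟧ else 0) (perms m)) ≡
                     (if b then count k l m (j ∸ s) else 0)
    by-cases true  = sym (count≡permSum m (j ∸ s))
    by-cases false = trans (sum-map-const 0 (perms m)) (*-zeroʳ (length (perms m)))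

  shiftedCount-+ : ∀ m {u j} d → u ≤ j → shiftedCount m (u + d) j ≡ shiftedCount m d (j ∸ u)
  shiftedCount-+ m {u} {j} d u≤j rewrite ≤ᵇ-∸ d u≤j | sym (∸-+-assoc j u d) = refl

  count-suc : ∀ n j → count k l (suc n) j ≡
              binomialSum n (λ a b → sumToℕ j (λ u → count k l a u * shiftedCount b (centred k l a b) (j ∸ u)))
  count-suc n j = begin
    count k l (suc n) j                    ≡⟨ count≡permSum (suc n) j ⟩
    permSum (suc n) (λ v → ⟦ v ≡ᵇ j ⟧)      ≡⟨ permSum-suc n (λ v → ⟦ v ≡ᵇ j ⟧) ⟩
    binomialPermSum n (λ v → ⟦ v ≡ᵇ j ⟧)    ≡⟨ ∑-cong n (λ i _ → cong ((n C i) *_) (term i (n ∸ i))) ⟩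
    binomialSum n (λ a b → sumToℕ j (λ u → count k l a u * shiftedCount b (centred k l a b) (j ∸ u))) ∎
    where
    term : ∀ a b → permSum a (λ u → permSum b (λ v → ⟦ u + v + centred k l a b ≡ᵇ j ⟧)) ≡
                   sumToℕ j (λ u → count k l a u * shiftedCount b (centred k l a b) (j ∸ u))
    term a b = begin
      permSum a (λ u → permSum b (λ v → ⟦ u + v + δ ≡ᵇ j ⟧))
        ≡⟨ sum-map-cong (perms a) (λ {π} _ → trans
             (sum-map-cong (perms b) (λ {ρ} _ → cong (λ x → ⟦ x ≡ᵇ j ⟧) (xy∙z≈xz∙y (occ k l π) (occ k l ρ) δ)))
             (permSum-shifted b (occ k l π + δ) j)) ⟩
      permSum a (λ u → shiftedCount b (u + δ) j)
        ≡⟨ permSum-expand a j (λ u → shiftedCount b (u + δ) j) vanish ⟩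
      sumToℕ j (λ u → count k l a u * shiftedCount b (u + δ) j)
        ≡⟨ ∑-cong j (λ u u≤j → cong (count k l a u *_) (shiftedCount-+ b δ u≤j)) ⟩
      sumToℕ j (λ u → count k l a u * shiftedCount b δ (j ∸ u)) ∎
      where
      δ : ℕ
      δ = centred k l a b
      vanish : ∀ u → j < u → shiftedCount b (u + δ) j ≡ 0
      vanish u j<u rewrite ≤ᵇ-false (<⇒≱ (<-≤-trans j<u (m≤m+n u δ))) = refl

module Fractions where

  open import Data.Nat as ℕ using (NonZero)
  open import Data.Nat.Properties as ℕ using (m*n≢0)
  open import Data.Nat.Solver using (module +-*-Solver)
  open import Data.Integer using (+_)
  import Data.Integer.Properties as ℤ
  open import Data.Rational using (0ℚ; _+_; _*_; _/_; fromℚᵘ)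
  open import Data.Rational.Properties using (fromℚᵘ-cong; toℚᵘ-injective; toℚᵘ-fromℚᵘ; toℚᵘ-homo-+; toℚᵘ-homo-*; 0/n≡0)
  open import Data.Rational.Unnormalised as ℚᵘ using (ℚᵘ; mkℚᵘ; *≡*; _≃_)
  import Data.Rational.Unnormalised.Properties as ℚᵘ
  open import Data.Bool using (true; false; if_then_else_)
  open import Relation.Binary.PropositionalEquality
  open +-*-Solver using (solve; _:=_; _:+_; _:*_; con)
  open NatSums using (sumToℕ)

  private
    fromℚᵘ-homo-+ : ∀ p q → fromℚᵘ (p ℚᵘ.+ q) ≡ fromℚᵘ p + fromℚᵘ q
    fromℚᵘ-homo-+ p q = toℚᵘ-injective (ℚᵘ.≃-trans (toℚᵘ-fromℚᵘ (p ℚᵘ.+ q))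
      (ℚᵘ.≃-sym (ℚᵘ.≃-trans (toℚᵘ-homo-+ (fromℚᵘ p) (fromℚᵘ q)) (ℚᵘ.+-cong (toℚᵘ-fromℚᵘ p) (toℚᵘ-fromℚᵘ q)))))

    fromℚᵘ-homo-* : ∀ p q → fromℚᵘ (p ℚᵘ.* q) ≡ fromℚᵘ p * fromℚᵘ q
    fromℚᵘ-homo-* p q = toℚᵘ-injective (ℚᵘ.≃-trans (toℚᵘ-fromℚᵘ (p ℚᵘ.* q))
      (ℚᵘ.≃-sym (ℚᵘ.≃-trans (toℚᵘ-homo-* (fromℚᵘ p) (fromℚᵘ q)) (ℚᵘ.*-cong (toℚᵘ-fromℚᵘ p) (toℚᵘ-fromℚᵘ q)))))

    mkℚᵘ-≃ : ∀ a c b d → a ℕ.* suc d ≡ b ℕ.* suc c → mkℚᵘ (+ a) c ≃ mkℚᵘ (+ b) d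
    mkℚᵘ-≃ a c b d eq = *≡* (trans (sym (ℤ.pos-* a (suc d))) (trans (cong +_ eq) (ℤ.pos-* b (suc c))))

  /-cross : ∀ a b c d .{{_ : NonZero c}} .{{_ : NonZero d}} → a ℕ.* d ≡ b ℕ.* c → + a / c ≡ + b / d
  /-cross a b (suc c) (suc d) eq = fromℚᵘ-cong (mkℚᵘ-≃ a c b d eq)

  /-+ : ∀ a b d .{{_ : NonZero d}} → + a / d + + b / d ≡ + (a ℕ.+ b) / d
  /-+ a b (suc d) = begin
    fromℚᵘ (mkℚᵘ (+ a) d) + fromℚᵘ (mkℚᵘ (+ b) d)
      ≡⟨ fromℚᵘ-homo-+ (mkℚᵘ (+ a) d) (mkℚᵘ (+ b) d) ⟨
    fromℚᵘ (mkℚᵘ (+ a ℤ* + suc d ℤ+ + b ℤ* + suc d) (d ℕ.+ d ℕ.* suc d))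
      ≡⟨ cong (λ z → fromℚᵘ (mkℚᵘ z (d ℕ.+ d ℕ.* suc d))) numerator ⟩
    fromℚᵘ (mkℚᵘ (+ (a ℕ.* suc d ℕ.+ b ℕ.* suc d)) (d ℕ.+ d ℕ.* suc d))
      ≡⟨ fromℚᵘ-cong (mkℚᵘ-≃ (a ℕ.* suc d ℕ.+ b ℕ.* suc d) (d ℕ.+ d ℕ.* suc d) (a ℕ.+ b) d
           (solve 3 (λ a b d → (a :* (con 1 :+ d) :+ b :* (con 1 :+ d)) :* (con 1 :+ d) :=
                               (a :+ b) :* (con 1 :+ (d :+ d :* (con 1 :+ d)))) refl a b d)) ⟩
    fromℚᵘ (mkℚᵘ (+ (a ℕ.+ b)) d) ∎
    where
    open ≡-Reasoning
    open import Data.Integer using () renaming (_*_ to _ℤ*_; _+_ to _ℤ+_)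
    numerator : + a ℤ* + suc d ℤ+ + b ℤ* + suc d ≡ + (a ℕ.* suc d ℕ.+ b ℕ.* suc d)
    numerator = trans (cong₂ _ℤ+_ (sym (ℤ.pos-* a (suc d))) (sym (ℤ.pos-* b (suc d))))
                      (sym (ℤ.pos-+ (a ℕ.* suc d) (b ℕ.* suc d)))

  /-* : ∀ a b c d .{{_ : NonZero c}} .{{_ : NonZero d}} →
        (+ a / c) * (+ b / d) ≡ (+ (a ℕ.* b) / (c ℕ.* d)) {{m*n≢0 c d}}
  /-* a b (suc c) (suc d) = trans (sym (fromℚᵘ-homo-* (mkℚᵘ (+ a) c) (mkℚᵘ (+ b) d)))
    (cong (λ z → fromℚᵘ (mkℚᵘ z (d ℕ.+ c ℕ.* suc d))) (sym (ℤ.pos-* a b)))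

  /-sumToℕ : ∀ n f d .{{_ : NonZero d}} → + sumToℕ n f / d ≡ sumTo n (λ i → + f i / d)
  /-sumToℕ zero    f d = refl
  /-sumToℕ (suc n) f d = trans (sym (/-+ (sumToℕ n f) (f (suc n)) d)) (cong (_+ + f (suc n) / d) (/-sumToℕ n f d))

  /-if : ∀ b a d .{{_ : NonZero d}} → + (if b then a else 0) / d ≡ (if b then + a / d else 0ℚ)
  /-if true  a d = refl
  /-if false a d = 0/n≡0 d

module SeriesCoefficients where

  open import Data.Bool using (Bool; true; false; if_then_else_)
  open import Data.Nat as ℕ using (_∸_; _≤_; _≤ᵇ_; _<ᵇ_; _≡ᵇ_; _≤?_; z≤n)
  open import Data.Nat.Properties using (≤-refl; +-∸-assoc; n∸n≡0; ≤∧≢⇒<; m∸[m∸n]≡n)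
  open import Data.Empty using (⊥-elim)
  open import Data.Integer using (+_)
  open import Data.Rational using (ℚ; 0ℚ; 1ℚ; _+_; _*_; _-_; _/_)
  open import Data.Rational.Properties
    using (+-*-isCommutativeRing; *-distribʳ-+; *-zeroˡ; *-zeroʳ; *-identityˡ; *-identityʳ; +-identityˡ; +-identityʳ)
  open import Algebra.Structures using (IsCommutativeRing)
  open import Data.Rational.Solver using (module +-*-Solver)
  open import Relation.Nullary using (yes; no)
  open import Relation.Binary.PropositionalEquality
  open import Function using (_∘_)
  open ≡-Reasoning
  open Fractions

  open RangeSum (IsCommutativeRing.isCommutativeSemiring +-*-isCommutativeRing)
                sumTo (λ _ → refl) (λ _ _ → refl) public

  ∑-distrib-- : ∀ n f g → sumTo n (λ i → f i - g i) ≡ sumTo n f - sumTo n g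
  ∑-distrib-- zero    f g = refl
  ∑-distrib-- (suc n) f g rewrite ∑-distrib-- n f g =
    solve 4 (λ a b c d → (a :- b) :+ (c :- d) := (a :+ c) :- (b :+ d)) refl
            (sumTo n f) (sumTo n g) (f (suc n)) (g (suc n))
    where open +-*-Solver

  ⟦_⟧ℚ : Bool → ℚ
  ⟦ b ⟧ℚ = if b then 1ℚ else 0ℚ

  δ₀ : ℕ → ℚ
  δ₀ zero    = 1ℚ
  δ₀ (suc _) = 0ℚ

  Constant : (ℕ → ℚ) → Set
  Constant g = ∀ j → g (suc j) ≡ 0ℚ

  -- A row j ↦ F n j of a series is a polynomial in y: conv multiplies two rows and yShift d
  -- multiplies a row by yᵈ.
  conv : (ℕ → ℚ) → (ℕ → ℚ) → ℕ → ℚ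
  conv f g j = sumTo j (λ u → f u * g (j ∸ u))

  yShift : ℕ → (ℕ → ℚ) → ℕ → ℚ
  yShift d g t = if d ≤ᵇ t then g (t ∸ d) else 0ℚ

  conv-cong : ∀ {f f′ g g′} j → (∀ u → f u ≡ f′ u) → (∀ t → g t ≡ g′ t) → conv f g j ≡ conv f′ g′ j
  conv-cong j f≗f′ g≗g′ = ∑-cong j (λ u _ → cong₂ _*_ (f≗f′ u) (g≗g′ (j ∸ u)))

  conv-constantˡ : ∀ {f} g j → Constant f → conv f g j ≡ f 0 * g j
  conv-constantˡ {f} g j f-const = ∑-single j 0 (λ u → f u * g (j ∸ u)) z≤n off-zero
    where
    off-zero : ∀ u → u ≤ j → u ≢ 0 → f u * g (j ∸ u) ≡ 0ℚ
    off-zero zero    _ 0≢0 = ⊥-elim (0≢0 refl)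
    off-zero (suc u) _ _   = trans (cong (_* g (j ∸ suc u)) (f-const u)) (*-zeroˡ (g (j ∸ suc u)))

  conv-constantʳ : ∀ f {g} j → Constant g → conv f g j ≡ f j * g 0
  conv-constantʳ f {g} j g-const = trans (∑-single j j (λ u → f u * g (j ∸ u)) ≤-refl off-diagonal)
                                         (cong (λ t → f j * g t) (n∸n≡0 j))
    where
    off-diagonal : ∀ u → u ≤ j → u ≢ j → f u * g (j ∸ u) ≡ 0ℚ
    off-diagonal u u≤j u≢j = begin
      f u * g (j ∸ u)               ≡⟨ cong (λ t → f u * g t) (+-∸-assoc 1 (≤∧≢⇒< u≤j u≢j)) ⟩
      f u * g (suc (j ∸ suc u))     ≡⟨ cong (f u *_) (g-const (j ∸ suc u)) ⟩
      f u * 0ℚ                      ≡⟨ *-zeroʳ (f u) ⟩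
      0ℚ                            ∎

  δ₀-constant : Constant δ₀
  δ₀-constant _ = refl

  conv-δ₀ˡ : ∀ g j → conv δ₀ g j ≡ g j
  conv-δ₀ˡ g j = trans (conv-constantˡ {δ₀} g j δ₀-constant) (*-identityˡ (g j))

  conv-δ₀ʳ : ∀ f j → conv f δ₀ j ≡ f j
  conv-δ₀ʳ f j = trans (conv-constantʳ f {δ₀} j δ₀-constant) (*-identityʳ (f j))

  conv-zeroˡ : ∀ {f} g j → (∀ u → f u ≡ 0ℚ) → conv f g j ≡ 0ℚ
  conv-zeroˡ {f} g j f≗0 =
    ∑-zeros j (λ u → f u * g (j ∸ u)) (λ u _ → trans (cong (_* g (j ∸ u)) (f≗0 u)) (*-zeroˡ (g (j ∸ u))))

  conv-zeroʳ : ∀ f {g} j → (∀ t → g t ≡ 0ℚ) → conv f g j ≡ 0ℚ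
  conv-zeroʳ f {g} j g≗0 =
    ∑-zeros j (λ u → f u * g (j ∸ u)) (λ u _ → trans (cong (f u *_) (g≗0 (j ∸ u))) (*-zeroʳ (f u)))

  conv-yShiftʳ : ∀ f g j → conv f (yShift 1 g) (suc j) ≡ conv f g j
  conv-yShiftʳ f g j = begin
    conv f (yShift 1 g) (suc j)
      ≡⟨⟩
    sumTo j (λ u → f u * yShift 1 g (suc j ∸ u)) + f (suc j) * yShift 1 g (j ∸ j)
      ≡⟨ cong₂ _+_ (∑-cong j (λ u u≤j → cong (λ t → f u * yShift 1 g t) (+-∸-assoc 1 u≤j)))
                   (trans (cong (λ t → f (suc j) * yShift 1 g t) (n∸n≡0 j)) (*-zeroʳ (f (suc j)))) ⟩
    conv f g j + 0ℚ
      ≡⟨ +-identityʳ (conv f g j) ⟩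
    conv f g j ∎

  conv-yShiftˡ : ∀ f g j → conv (yShift 1 f) g (suc j) ≡ conv f g j
  conv-yShiftˡ f g j = begin
    conv (yShift 1 f) g (suc j)
      ≡⟨ ∑-shift j (λ u → yShift 1 f u * g (suc j ∸ u)) ⟩
    0ℚ * g (suc j) + conv f g j
      ≡⟨ cong (_+ conv f g j) (*-zeroˡ (g (suc j))) ⟩
    0ℚ + conv f g j
      ≡⟨ +-identityˡ (conv f g j) ⟩
    conv f g j ∎

  conv-yShift : ∀ f g j → conv f (yShift 1 g) j ≡ conv (yShift 1 f) g j
  conv-yShift f g zero    = trans (*-zeroʳ (f 0)) (sym (*-zeroˡ (g 0)))
  conv-yShift f g (suc j) = trans (conv-yShiftʳ f g j) (sym (conv-yShiftˡ f g j))

  record XOnly (F : Series) : Set where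
    constructor x-only
    field
      row-constant : ∀ n → Constant (F n)

  open XOnly

  ⊛-XOnlyˡ : ∀ {F} G n j → XOnly F → (F ⊛ G) n j ≡ sumTo n (λ a → F a 0 * G (n ∸ a) j)
  ⊛-XOnlyˡ {F} G n j F-x = ∑-cong n (λ a _ → conv-constantˡ {F a} (G (n ∸ a)) j (row-constant F-x a))

  ⊛-XOnlyʳ : ∀ F {G} n j → XOnly G → (F ⊛ G) n j ≡ sumTo n (λ a → F a j * G (n ∸ a) 0)
  ⊛-XOnlyʳ F {G} n j G-x = ∑-cong n (λ a _ → conv-constantʳ (F a) {G (n ∸ a)} j (row-constant G-x (n ∸ a)))

  XOnly-⊛ : ∀ {F G} → XOnly F → XOnly G → XOnly (F ⊛ G)
  XOnly-⊛ {F} {G} F-x G-x = x-only λ n j →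
    trans (⊛-XOnlyʳ F n (suc j) G-x)
          (∑-zeros n (λ a → F a (suc j) * G (n ∸ a) 0)
                   (λ a _ → trans (cong (_* G (n ∸ a) 0) (row-constant F-x a j)) (*-zeroˡ (G (n ∸ a) 0))))

  XOnly-⊕ : ∀ {F G} → XOnly F → XOnly G → XOnly (F ⊕ G)
  XOnly-⊕ F-x G-x = x-only λ n j → cong₂ _+_ (row-constant F-x n j) (row-constant G-x n j)

  XOnly-⊖ : ∀ {F G} → XOnly F → XOnly G → XOnly (F ⊖ G)
  XOnly-⊖ F-x G-x = x-only λ n j → cong₂ _-_ (row-constant F-x n j) (row-constant G-x n j)

  XOnly-const : ∀ c → XOnly (const c)
  XOnly-const c = x-only λ { zero _ → refl ; (suc n) _ → refl }

  XOnly-X^ : ∀ m → XOnly (X^ m)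
  XOnly-X^ m = x-only λ _ _ → refl

  XOnly-inv1-X : XOnly inv1-X
  XOnly-inv1-X = x-only λ _ _ → refl

  ⊛-inv1-X : ∀ F n j → (F ⊛ inv1-X) n j ≡ sumTo n (λ a → F a j)
  ⊛-inv1-X F n j = trans (⊛-XOnlyʳ F {inv1-X} n j XOnly-inv1-X) (∑-cong n (λ a _ → *-identityʳ (F a j)))

  Y-⊛ : ∀ F n j → (Y ⊛ F) n j ≡ yShift 1 (F n) j
  Y-⊛ F n j = begin
    (Y ⊛ F) n j
      ≡⟨ ∑-single n 0 (λ a → conv (Y a) (F (n ∸ a)) j) z≤n Y-row-zero ⟩
    conv (Y 0) (F n) j
      ≡⟨ conv-cong {g = F n} {g′ = F n} j Y₀≗ (λ _ → refl) ⟩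
    conv (yShift 1 δ₀) (F n) j
      ≡⟨ conv-yShift δ₀ (F n) j ⟨
    conv δ₀ (yShift 1 (F n)) j
      ≡⟨ conv-δ₀ˡ (yShift 1 (F n)) j ⟩
    yShift 1 (F n) j ∎
    where
    Y-row-zero : ∀ a → a ≤ n → a ≢ 0 → conv (Y a) (F (n ∸ a)) j ≡ 0ℚ
    Y-row-zero zero    _ 0≢0 = ⊥-elim (0≢0 refl)
    Y-row-zero (suc a) _ _   = conv-zeroˡ {Y (suc a)} (F (n ∸ suc a)) j (λ _ → refl)
    Y₀≗ : ∀ t → Y 0 t ≡ yShift 1 δ₀ t
    Y₀≗ zero          = refl
    Y₀≗ (suc zero)    = refl
    Y₀≗ (suc (suc t)) = refl

  ∑-const : ∀ c n → sumTo n (λ a → const c a 0) ≡ c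
  ∑-const c n = ∑-single n 0 (λ a → const c a 0) z≤n off-zero
    where
    off-zero : ∀ a → a ≤ n → a ≢ 0 → const c a 0 ≡ 0ℚ
    off-zero zero    _ 0≢0 = ⊥-elim (0≢0 refl)
    off-zero (suc a) _ _   = refl

  ∑-⟦≡ᵇ⟧ : ∀ m n (g : ℕ → ℚ) → sumTo n (λ a → ⟦ m ≡ᵇ a ⟧ℚ * g a) ≡ ⟦ m ≤ᵇ n ⟧ℚ * g m
  ∑-⟦≡ᵇ⟧ m n g with m ≤? n
  ... | yes m≤n rewrite ≤ᵇ-true m≤n =
    trans (∑-single n m (λ a → ⟦ m ≡ᵇ a ⟧ℚ * g a) m≤n
             (λ a _ a≢m → trans (cong (λ b → ⟦ b ⟧ℚ * g a) (≡ᵇ-false {m} {a} (a≢m ∘ sym))) (*-zeroˡ (g a))))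
          (cong (λ b → ⟦ b ⟧ℚ * g m) (≡ᵇ-true {m} refl))
  ... | no m≰n rewrite ≤ᵇ-false m≰n =
    trans (∑-zeros n (λ a → ⟦ m ≡ᵇ a ⟧ℚ * g a)
             (λ a a≤n → trans (cong (λ b → ⟦ b ⟧ℚ * g a) (≡ᵇ-false {m} {a} λ { refl → m≰n a≤n })) (*-zeroˡ (g a))))
          (sym (*-zeroˡ (g m)))

  ∑-X^ : ∀ m n → sumTo n (λ a → X^ m a 0) ≡ ⟦ m ≤ᵇ n ⟧ℚ
  ∑-X^ m n = trans (∑-cong n (λ a _ → sym (*-identityʳ ⟦ m ≡ᵇ a ⟧ℚ)))
                   (trans (∑-⟦≡ᵇ⟧ m n (λ _ → 1ℚ)) (*-identityʳ ⟦ m ≤ᵇ n ⟧ℚ))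

  ⟦<ᵇ⟧-complement : ∀ a m → ⟦ a <ᵇ m ⟧ℚ ≡ 1ℚ - ⟦ m ≤ᵇ a ⟧ℚ
  ⟦<ᵇ⟧-complement zero    zero    = refl
  ⟦<ᵇ⟧-complement zero    (suc m) = refl
  ⟦<ᵇ⟧-complement (suc a) zero    = refl
  ⟦<ᵇ⟧-complement (suc a) (suc m) rewrite <ᵇ-suc m a = ⟦<ᵇ⟧-complement a m

  ⟦≤ᵇ⟧-split : ∀ k a → ⟦ k ≤ᵇ a ⟧ℚ ≡ ⟦ suc k ≤ᵇ a ⟧ℚ + ⟦ k ≡ᵇ a ⟧ℚ
  ⟦≤ᵇ⟧-split zero    zero    = refl
  ⟦≤ᵇ⟧-split zero    (suc a) = refl
  ⟦≤ᵇ⟧-split (suc k) zero    = refl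
  ⟦≤ᵇ⟧-split (suc k) (suc a) rewrite <ᵇ-suc k a = ⟦≤ᵇ⟧-split k a

  ⟦<ᵇ⟧-split : ∀ a k → ⟦ a <ᵇ suc k ⟧ℚ ≡ ⟦ a <ᵇ k ⟧ℚ + ⟦ k ≡ᵇ a ⟧ℚ
  ⟦<ᵇ⟧-split zero    zero    = refl
  ⟦<ᵇ⟧-split zero    (suc k) = refl
  ⟦<ᵇ⟧-split (suc a) zero    = refl
  ⟦<ᵇ⟧-split (suc a) (suc k) = ⟦<ᵇ⟧-split a k

  ⟦≤ᵇ⟧-window : ∀ k l n → ⟦ k ≤ᵇ n ⟧ℚ - ⟦ k ℕ.+ l ≤ᵇ n ⟧ℚ ≡ ⟦ k ≤ᵇ n ⟧ℚ * ⟦ n ∸ k <ᵇ l ⟧ℚ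
  ⟦≤ᵇ⟧-window zero    l n       = trans (sym (⟦<ᵇ⟧-complement n l)) (sym (*-identityˡ ⟦ n <ᵇ l ⟧ℚ))
  ⟦≤ᵇ⟧-window (suc k) l zero    = sym (*-zeroˡ ⟦ 0 <ᵇ l ⟧ℚ)
  ⟦≤ᵇ⟧-window (suc k) l (suc n) rewrite <ᵇ-suc k n | <ᵇ-suc (k ℕ.+ l) n = ⟦≤ᵇ⟧-window k l n

  -- Raising k by one adds [k ≤ n] − [k + l ≤ n] = [k ≤ n][n − k < l] to both sides.
  ∑-window : ∀ k l n → sumTo n (λ a → 1ℚ - ⟦ k ≤ᵇ a ⟧ℚ - ⟦ l ≤ᵇ a ⟧ℚ + ⟦ k ℕ.+ l ≤ᵇ a ⟧ℚ) ≡
                       sumTo n (λ a → ⟦ a <ᵇ k ⟧ℚ * ⟦ n ∸ a <ᵇ l ⟧ℚ)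
  ∑-window zero l n =
    trans (∑-zeros n _ (λ a _ → solve 1 (λ x → con 1ℚ :- con 1ℚ :- x :+ x := con 0ℚ) refl ⟦ l ≤ᵇ a ⟧ℚ))
          (sym (∑-zeros n _ (λ a _ → *-zeroˡ ⟦ n ∸ a <ᵇ l ⟧ℚ)))
    where open +-*-Solver
  ∑-window (suc k) l n = begin
    sumTo n (λ a → 1ℚ - ⟦ suc k ≤ᵇ a ⟧ℚ - ⟦ l ≤ᵇ a ⟧ℚ + ⟦ suc (k ℕ.+ l) ≤ᵇ a ⟧ℚ)
      ≡⟨ ∑-cong n (λ a _ → step a) ⟩
    sumTo n (λ a → (1ℚ - ⟦ k ≤ᵇ a ⟧ℚ - ⟦ l ≤ᵇ a ⟧ℚ + ⟦ k ℕ.+ l ≤ᵇ a ⟧ℚ) + (⟦ k ≡ᵇ a ⟧ℚ - ⟦ k ℕ.+ l ≡ᵇ a ⟧ℚ))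
      ≡⟨ ∑-distrib-+ n _ _ ⟩
    sumTo n (λ a → 1ℚ - ⟦ k ≤ᵇ a ⟧ℚ - ⟦ l ≤ᵇ a ⟧ℚ + ⟦ k ℕ.+ l ≤ᵇ a ⟧ℚ) + sumTo n (λ a → ⟦ k ≡ᵇ a ⟧ℚ - ⟦ k ℕ.+ l ≡ᵇ a ⟧ℚ)
      ≡⟨ cong₂ _+_ (∑-window k l n) (trans (∑-distrib-- n _ _) (cong₂ _-_ (∑-X^ k n) (∑-X^ (k ℕ.+ l) n))) ⟩
    sumTo n (λ a → ⟦ a <ᵇ k ⟧ℚ * ⟦ n ∸ a <ᵇ l ⟧ℚ) + (⟦ k ≤ᵇ n ⟧ℚ - ⟦ k ℕ.+ l ≤ᵇ n ⟧ℚ)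
      ≡⟨ cong (λ z → sumTo n (λ a → ⟦ a <ᵇ k ⟧ℚ * ⟦ n ∸ a <ᵇ l ⟧ℚ) + z)
              (trans (⟦≤ᵇ⟧-window k l n) (sym (∑-⟦≡ᵇ⟧ k n (λ a → ⟦ n ∸ a <ᵇ l ⟧ℚ)))) ⟩
    sumTo n (λ a → ⟦ a <ᵇ k ⟧ℚ * ⟦ n ∸ a <ᵇ l ⟧ℚ) + sumTo n (λ a → ⟦ k ≡ᵇ a ⟧ℚ * ⟦ n ∸ a <ᵇ l ⟧ℚ)
      ≡⟨ ∑-distrib-+ n _ _ ⟨
    sumTo n (λ a → ⟦ a <ᵇ k ⟧ℚ * ⟦ n ∸ a <ᵇ l ⟧ℚ + ⟦ k ≡ᵇ a ⟧ℚ * ⟦ n ∸ a <ᵇ l ⟧ℚ)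
      ≡⟨ ∑-cong n (λ a _ → trans (sym (*-distribʳ-+ ⟦ n ∸ a <ᵇ l ⟧ℚ ⟦ a <ᵇ k ⟧ℚ ⟦ k ≡ᵇ a ⟧ℚ))
                                 (cong (_* ⟦ n ∸ a <ᵇ l ⟧ℚ) (sym (⟦<ᵇ⟧-split a k)))) ⟩
    sumTo n (λ a → ⟦ a <ᵇ suc k ⟧ℚ * ⟦ n ∸ a <ᵇ l ⟧ℚ) ∎
    where
    step : ∀ a → 1ℚ - ⟦ suc k ≤ᵇ a ⟧ℚ - ⟦ l ≤ᵇ a ⟧ℚ + ⟦ suc (k ℕ.+ l) ≤ᵇ a ⟧ℚ ≡
                 (1ℚ - ⟦ k ≤ᵇ a ⟧ℚ - ⟦ l ≤ᵇ a ⟧ℚ + ⟦ k ℕ.+ l ≤ᵇ a ⟧ℚ) + (⟦ k ≡ᵇ a ⟧ℚ - ⟦ k ℕ.+ l ≡ᵇ a ⟧ℚ)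
    step a rewrite ⟦≤ᵇ⟧-split k a | ⟦≤ᵇ⟧-split (k ℕ.+ l) a =
      solve 5 (λ x e L y f → con 1ℚ :- x :- L :+ y := (con 1ℚ :- (x :+ e) :- L :+ (y :+ f)) :+ (e :- f)) refl
        ⟦ suc k ≤ᵇ a ⟧ℚ ⟦ k ≡ᵇ a ⟧ℚ ⟦ l ≤ᵇ a ⟧ℚ ⟦ suc (k ℕ.+ l) ≤ᵇ a ⟧ℚ ⟦ k ℕ.+ l ≡ᵇ a ⟧ℚ
      where open +-*-Solver

  yShift-cong : ∀ d {g g′} → (∀ t → g t ≡ g′ t) → ∀ t → yShift d g t ≡ yShift d g′ t
  yShift-cong d g≗g′ t = cong (λ x → if d ≤ᵇ t then x else 0ℚ) (g≗g′ (t ∸ d))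

  yShift-zero : ∀ d {g} → (∀ t → g t ≡ 0ℚ) → ∀ t → yShift d g t ≡ 0ℚ
  yShift-zero d {g} g≗0 t with d ≤ᵇ t
  ... | true  = g≗0 (t ∸ d)
  ... | false = refl

  geom : ℕ → Series
  geom m = (const 1ℚ ⊖ X^ m) ⊛ inv1-X

  geom-coeff : ∀ m n j → geom m n j ≡ δ₀ j * ⟦ n <ᵇ m ⟧ℚ
  geom-coeff m n zero = begin
    geom m n 0
      ≡⟨ ⊛-inv1-X (const 1ℚ ⊖ X^ m) n 0 ⟩
    sumTo n (λ a → const 1ℚ a 0 - X^ m a 0)
      ≡⟨ ∑-distrib-- n (λ a → const 1ℚ a 0) (λ a → X^ m a 0) ⟩
    sumTo n (λ a → const 1ℚ a 0) - sumTo n (λ a → X^ m a 0)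
      ≡⟨ cong₂ _-_ (∑-const 1ℚ n) (∑-X^ m n) ⟩
    1ℚ - ⟦ m ≤ᵇ n ⟧ℚ
      ≡⟨ ⟦<ᵇ⟧-complement n m ⟨
    ⟦ n <ᵇ m ⟧ℚ
      ≡⟨ *-identityˡ ⟦ n <ᵇ m ⟧ℚ ⟨
    δ₀ 0 * ⟦ n <ᵇ m ⟧ℚ ∎
  geom-coeff m n (suc j) =
    trans (row-constant (XOnly-⊛ (XOnly-⊖ (XOnly-const 1ℚ) (XOnly-X^ m)) XOnly-inv1-X) n j) (sym (*-zeroˡ ⟦ n <ᵇ m ⟧ℚ))

  ⊛-two-minus-geoms : ∀ k l F n j →
    ((const (+ 2 / 1) ⊖ X^ k ⊖ X^ l) ⊛ inv1-X ⊛ F) n j ≡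
    sumTo n (λ a → ⟦ a <ᵇ k ⟧ℚ * F (n ∸ a) j) + sumTo n (λ a → ⟦ n ∸ a <ᵇ l ⟧ℚ * F a j)
  ⊛-two-minus-geoms k l F n j = begin
    ((T ⊛ inv1-X) ⊛ F) n j
      ≡⟨ ⊛-XOnlyˡ F n j (XOnly-⊛ T-XOnly XOnly-inv1-X) ⟩
    sumTo n (λ a → (T ⊛ inv1-X) a 0 * F (n ∸ a) j)
      ≡⟨ ∑-cong n (λ a _ → trans (cong (_* F (n ∸ a) j) (coeff a))
                                 (*-distribʳ-+ (F (n ∸ a) j) ⟦ a <ᵇ k ⟧ℚ ⟦ a <ᵇ l ⟧ℚ)) ⟩
    sumTo n (λ a → ⟦ a <ᵇ k ⟧ℚ * F (n ∸ a) j + ⟦ a <ᵇ l ⟧ℚ * F (n ∸ a) j)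
      ≡⟨ ∑-distrib-+ n _ _ ⟩
    sumTo n (λ a → ⟦ a <ᵇ k ⟧ℚ * F (n ∸ a) j) + sumTo n (λ a → ⟦ a <ᵇ l ⟧ℚ * F (n ∸ a) j)
      ≡⟨ cong (λ z → sumTo n (λ a → ⟦ a <ᵇ k ⟧ℚ * F (n ∸ a) j) + z) reversed ⟩
    sumTo n (λ a → ⟦ a <ᵇ k ⟧ℚ * F (n ∸ a) j) + sumTo n (λ a → ⟦ n ∸ a <ᵇ l ⟧ℚ * F a j) ∎
    where
    T : Series
    T = const (+ 2 / 1) ⊖ X^ k ⊖ X^ l
    T-XOnly : XOnly T
    T-XOnly = XOnly-⊖ (XOnly-⊖ (XOnly-const (+ 2 / 1)) (XOnly-X^ k)) (XOnly-X^ l)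
    coeff : ∀ a → (T ⊛ inv1-X) a 0 ≡ ⟦ a <ᵇ k ⟧ℚ + ⟦ a <ᵇ l ⟧ℚ
    coeff a = begin
      (T ⊛ inv1-X) a 0
        ≡⟨ ⊛-inv1-X T a 0 ⟩
      sumTo a (λ b → const (+ 2 / 1) b 0 - X^ k b 0 - X^ l b 0)
        ≡⟨ trans (∑-distrib-- a _ _) (cong (_- sumTo a (λ b → X^ l b 0)) (∑-distrib-- a _ _)) ⟩
      sumTo a (λ b → const (+ 2 / 1) b 0) - sumTo a (λ b → X^ k b 0) - sumTo a (λ b → X^ l b 0)
        ≡⟨ cong₂ _-_ (cong₂ _-_ (∑-const (+ 2 / 1) a) (∑-X^ k a)) (∑-X^ l a) ⟩
      (+ 2 / 1) - ⟦ k ≤ᵇ a ⟧ℚ - ⟦ l ≤ᵇ a ⟧ℚ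
        ≡⟨ solve 2 (λ x y → con (+ 2 / 1) :- x :- y := (con 1ℚ :- x) :+ (con 1ℚ :- y)) refl ⟦ k ≤ᵇ a ⟧ℚ ⟦ l ≤ᵇ a ⟧ℚ ⟩
      (1ℚ - ⟦ k ≤ᵇ a ⟧ℚ) + (1ℚ - ⟦ l ≤ᵇ a ⟧ℚ)
        ≡⟨ cong₂ _+_ (⟦<ᵇ⟧-complement a k) (⟦<ᵇ⟧-complement a l) ⟨
      ⟦ a <ᵇ k ⟧ℚ + ⟦ a <ᵇ l ⟧ℚ ∎
      where open +-*-Solver
    reversed : sumTo n (λ a → ⟦ a <ᵇ l ⟧ℚ * F (n ∸ a) j) ≡ sumTo n (λ a → ⟦ n ∸ a <ᵇ l ⟧ℚ * F a j)
    reversed = trans (sym (∑-reverse n (λ a → ⟦ a <ᵇ l ⟧ℚ * F (n ∸ a) j)))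
                     (∑-cong n (λ a a≤n → cong (λ b → ⟦ n ∸ a <ᵇ l ⟧ℚ * F b j) (m∸[m∸n]≡n a≤n)))

  ⊛-window : ∀ k l n j → ((const 1ℚ ⊖ X^ k ⊖ X^ l ⊕ X^ (k ℕ.+ l)) ⊛ inv1-X ⊛ inv1-X) n j ≡
                         δ₀ j * sumTo n (λ a → ⟦ a <ᵇ k ⟧ℚ * ⟦ n ∸ a <ᵇ l ⟧ℚ)
  ⊛-window k l n zero = begin
    ((W ⊛ inv1-X) ⊛ inv1-X) n 0
      ≡⟨ ⊛-inv1-X (W ⊛ inv1-X) n 0 ⟩
    sumTo n (λ a → (W ⊛ inv1-X) a 0)
      ≡⟨ ∑-cong n (λ a _ → coeff a) ⟩
    sumTo n (λ a → 1ℚ - ⟦ k ≤ᵇ a ⟧ℚ - ⟦ l ≤ᵇ a ⟧ℚ + ⟦ k ℕ.+ l ≤ᵇ a ⟧ℚ)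
      ≡⟨ ∑-window k l n ⟩
    sumTo n (λ a → ⟦ a <ᵇ k ⟧ℚ * ⟦ n ∸ a <ᵇ l ⟧ℚ)
      ≡⟨ *-identityˡ _ ⟨
    δ₀ 0 * sumTo n (λ a → ⟦ a <ᵇ k ⟧ℚ * ⟦ n ∸ a <ᵇ l ⟧ℚ) ∎
    where
    W : Series
    W = const 1ℚ ⊖ X^ k ⊖ X^ l ⊕ X^ (k ℕ.+ l)
    coeff : ∀ a → (W ⊛ inv1-X) a 0 ≡ 1ℚ - ⟦ k ≤ᵇ a ⟧ℚ - ⟦ l ≤ᵇ a ⟧ℚ + ⟦ k ℕ.+ l ≤ᵇ a ⟧ℚ
    coeff a = begin
      (W ⊛ inv1-X) a 0
        ≡⟨ ⊛-inv1-X W a 0 ⟩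
      sumTo a (λ b → const 1ℚ b 0 - X^ k b 0 - X^ l b 0 + X^ (k ℕ.+ l) b 0)
        ≡⟨ trans (∑-distrib-+ a _ _) (cong (_+ sumTo a (λ b → X^ (k ℕ.+ l) b 0))
             (trans (∑-distrib-- a _ _) (cong (_- sumTo a (λ b → X^ l b 0)) (∑-distrib-- a _ _)))) ⟩
      sumTo a (λ b → const 1ℚ b 0) - sumTo a (λ b → X^ k b 0) - sumTo a (λ b → X^ l b 0)
        + sumTo a (λ b → X^ (k ℕ.+ l) b 0)
        ≡⟨ cong₂ _+_ (cong₂ _-_ (cong₂ _-_ (∑-const 1ℚ a) (∑-X^ k a)) (∑-X^ l a)) (∑-X^ (k ℕ.+ l) a) ⟩
      1ℚ - ⟦ k ≤ᵇ a ⟧ℚ - ⟦ l ≤ᵇ a ⟧ℚ + ⟦ k ℕ.+ l ≤ᵇ a ⟧ℚ ∎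
  ⊛-window k l n (suc j) =
    trans (row-constant (XOnly-⊛ (XOnly-⊛ W-XOnly XOnly-inv1-X) XOnly-inv1-X) n j)
          (sym (*-zeroˡ (sumTo n (λ a → ⟦ a <ᵇ k ⟧ℚ * ⟦ n ∸ a <ᵇ l ⟧ℚ))))
    where
    W-XOnly : XOnly (const 1ℚ ⊖ X^ k ⊖ X^ l ⊕ X^ (k ℕ.+ l))
    W-XOnly = XOnly-⊕ (XOnly-⊖ (XOnly-⊖ (XOnly-const 1ℚ) (XOnly-X^ k)) (XOnly-X^ l)) (XOnly-X^ (k ℕ.+ l))

module GeneratingFunction (k l : ℕ) where

  open import Data.Nat as ℕ using (_∸_; _≤_; _!; _≤ᵇ_; NonZero)
  open import Data.Nat.Properties as ℕ using (_!≢0; _!*_!≢0; m*n≢0)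
  open import Data.Nat.Combinatorics using (_C_)
  open import Data.Nat.Solver using (module +-*-Solver)
  open import Data.Integer using (+_)
  open import Data.Rational using (ℚ; _+_; _*_; _/_)
  open import Data.Rational.Properties using (0/n≡0)
  open import Relation.Binary.PropositionalEquality
  open ≡-Reasoning
  open Occurrences using (centred)
  open Counting k l using (count-small; count-suc; shiftedCount)
  open NatSums using (sumToℕ; binomialSum; nCk*k!*[n∸k]!≡n!)
  open Fractions
  open SeriesCoefficients

  infix 8 _÷_!

  _÷_! : ℕ → ℕ → ℚ
  a ÷ m ! = (+ a / m !) {{m !≢0}}

  P-small : ∀ {m} → m ≤ k ℕ.+ l → ∀ j → P k l m j ≡ δ₀ j
  P-small {m} m≤k+l zero    = trans (cong (_÷ m !) (count-small m 0 m≤k+l))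
                                    (/-cross (1 ℕ.* m !) 1 (m !) 1 {{m !≢0}} (ℕ.*-identityʳ (1 ℕ.* m !)))
  P-small {m} m≤k+l (suc j) = trans (cong (_÷ m !) (count-small m (suc j) m≤k+l)) (0/n≡0 (m !) {{m !≢0}})

  P-yShift : ∀ m d t → shiftedCount m d t ÷ m ! ≡ yShift d (P k l m) t
  P-yShift m d t = /-if (d ≤ᵇ t) (count k l m (t ∸ d)) (m !) {{m !≢0}}

  ∑-÷! : ∀ n f m → sumToℕ n f ÷ m ! ≡ sumTo n (λ i → f i ÷ m !)
  ∑-÷! n f m = /-sumToℕ n f (m !) {{m !≢0}}

  binomial-term : ∀ {n i} → i ≤ n → ∀ c s → ((n C i) ℕ.* (c ℕ.* s)) ÷ n ! ≡ (c ÷ i !) * (s ÷ (n ∸ i) !)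
  binomial-term {n} {i} i≤n c s = begin
    ((n C i) ℕ.* (c ℕ.* s)) ÷ n !
      ≡⟨ /-cross ((n C i) ℕ.* (c ℕ.* s)) (c ℕ.* s) (n !) (i ! ℕ.* (n ∸ i) !) {{n !≢0}} {{i !* (n ∸ i) !≢0}} cross ⟩
    (+ (c ℕ.* s) / (i ! ℕ.* (n ∸ i) !)) {{i !* (n ∸ i) !≢0}}
      ≡⟨ /-* c s (i !) ((n ∸ i) !) {{i !≢0}} {{(n ∸ i) !≢0}} ⟨
    (c ÷ i !) * (s ÷ (n ∸ i) !) ∎
    where
    open +-*-Solver
    cross : (n C i) ℕ.* (c ℕ.* s) ℕ.* (i ! ℕ.* (n ∸ i) !) ≡ c ℕ.* s ℕ.* n !
    cross = trans (solve 3 (λ C x f → C :* x :* f := x :* (C :* f)) refl (n C i) (c ℕ.* s) (i ! ℕ.* (n ∸ i) !))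
                  (cong (c ℕ.* s ℕ.*_) (nCk*k!*[n∸k]!≡n! i≤n))

  ∂x-÷! : ∀ n c → (+ suc n / 1) * (c ÷ suc n !) ≡ c ÷ n !
  ∂x-÷! n c = trans (/-* (suc n) c 1 (suc n !) {{_}} {{suc n !≢0}})
                    (/-cross (suc n ℕ.* c) c (1 ℕ.* suc n !) (n !) {{1*[1+n]!≢0}} {{n !≢0}} cross)
    where
    open +-*-Solver
    1*[1+n]!≢0 : NonZero (1 ℕ.* suc n !)
    1*[1+n]!≢0 = m*n≢0 1 (suc n !) {{_}} {{suc n !≢0}}
    cross : suc n ℕ.* c ℕ.* n ! ≡ c ℕ.* (1 ℕ.* suc n !)
    cross = solve 3 (λ n c f → (con 1 :+ n) :* c :* f := c :* (con 1 :* ((con 1 :+ n) :* f))) refl n c (n !)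

  ∂x-P : ∀ n j → ∂x (P k l) n j ≡ sumTo n (λ i → conv (P k l i) (yShift (centred k l i (n ∸ i)) (P k l (n ∸ i))) j)
  ∂x-P n j = begin
    (+ suc n / 1) * (count k l (suc n) j ÷ suc n !)
      ≡⟨ ∂x-÷! n (count k l (suc n) j) ⟩
    count k l (suc n) j ÷ n !
      ≡⟨ cong (_÷ n !) (count-suc n j) ⟩
    binomialSum n (λ a b → sumToℕ j (λ u → count k l a u ℕ.* shiftedCount b (centred k l a b) (j ∸ u))) ÷ n !
      ≡⟨ ∑-÷! n _ n ⟩
    sumTo n (λ i → ((n C i) ℕ.* sumToℕ j (λ u → count k l i u ℕ.* shifted i (j ∸ u))) ÷ n !)
      ≡⟨ ∑-cong n (λ i i≤n → row i i≤n) ⟩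
    sumTo n (λ i → conv (P k l i) (yShift (centred k l i (n ∸ i)) (P k l (n ∸ i))) j) ∎
    where
    shifted : ℕ → ℕ → ℕ
    shifted i = shiftedCount (n ∸ i) (centred k l i (n ∸ i))
    row : ∀ i → i ≤ n → ((n C i) ℕ.* sumToℕ j (λ u → count k l i u ℕ.* shifted i (j ∸ u))) ÷ n ! ≡
                        conv (P k l i) (yShift (centred k l i (n ∸ i)) (P k l (n ∸ i))) j
    row i i≤n = begin
      ((n C i) ℕ.* sumToℕ j (λ u → count k l i u ℕ.* shifted i (j ∸ u))) ÷ n !
        ≡⟨ cong (_÷ n !) (NatSums.∑-distribˡ j (n C i) _) ⟨
      sumToℕ j (λ u → (n C i) ℕ.* (count k l i u ℕ.* shifted i (j ∸ u))) ÷ n !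
        ≡⟨ ∑-÷! j _ n ⟩
      sumTo j (λ u → ((n C i) ℕ.* (count k l i u ℕ.* shifted i (j ∸ u))) ÷ n !)
        ≡⟨ ∑-cong j (λ u _ → trans (binomial-term i≤n (count k l i u) (shifted i (j ∸ u)))
                                    (cong (P k l i u *_) (P-yShift (n ∸ i) (centred k l i (n ∸ i)) (j ∸ u)))) ⟩
      conv (P k l i) (yShift (centred k l i (n ∸ i)) (P k l (n ∸ i))) j ∎

-- F stands for P k l; keeping it abstract stops Agda from unfolding the definition of P while
-- checking the algebra below.
module Expansion (k l : ℕ) (F : Series)
                 (F-small : ∀ {m} → m ≤ k Data.Nat.+ l → ∀ j → F m j ≡ SeriesCoefficients.δ₀ j) where

  open import Data.Nat.Properties using (≤-trans; <⇒≤; m≤m+n; m≤n+m; ≮⇒≥; ≤⇒≯)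
  open import Data.Nat as ℕ using (_∸_; _<_; _<ᵇ_; _<?_)
  open import Data.Integer using (+_)
  open import Data.Rational using (ℚ; 0ℚ; 1ℚ; _+_; _*_; _-_; _/_)
  open import Data.Rational.Properties using (*-zeroʳ; +-identityʳ; +-assoc)
  import Data.Rational.Solver as ℚ-Solver
  open import Relation.Binary.PropositionalEquality
  open import Relation.Nullary using (yes; no)
  open ≡-Reasoning
  open Occurrences using (centred; centred-≥≥; centred-<ˡ; centred-<ʳ)
  open SeriesCoefficients

  A B : Series
  A = F ⊖ geom k
  B = F ⊖ geom l

  F-minus-geom-below : ∀ {r m} → m < r → r ≤ k ℕ.+ l → ∀ u → (F ⊖ geom r) m u ≡ 0ℚ
  F-minus-geom-below {r} {m} m<r r≤k+l u
    rewrite F-small (≤-trans (<⇒≤ m<r) r≤k+l) u | geom-coeff r m u | <ᵇ-true m<r with u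
  ... | zero  = refl
  ... | suc _ = refl

  F-minus-geom-above : ∀ {r m} → r ≤ m → ∀ u → (F ⊖ geom r) m u ≡ F m u
  F-minus-geom-above {r} {m} r≤m u
    rewrite geom-coeff r m u | <ᵇ-false (≤⇒≯ r≤m) | *-zeroʳ (δ₀ u) = +-identityʳ (F m u)

  rhs-term : ℕ → ℕ → ℕ → ℚ
  rhs-term a b j = conv (yShift 1 (A a)) (B b) j + ⟦ a <ᵇ k ⟧ℚ * F b j + ⟦ b <ᵇ l ⟧ℚ * F a j
                     - δ₀ j * (⟦ a <ᵇ k ⟧ℚ * ⟦ b <ᵇ l ⟧ℚ)

  rhs-term-at : ∀ a b j {p q} → ⟦ a <ᵇ k ⟧ℚ ≡ p → ⟦ b <ᵇ l ⟧ℚ ≡ q →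
                rhs-term a b j ≡ conv (yShift 1 (A a)) (B b) j + p * F b j + q * F a j - δ₀ j * (p * q)
  rhs-term-at a b j refl refl = refl

  term-identity-≥≥ : ∀ {a b} j → k ≤ a → l ≤ b → conv (F a) (yShift (centred k l a b) (F b)) j ≡ rhs-term a b j
  term-identity-≥≥ {a} {b} j k≤a l≤b = begin
    conv (F a) (yShift (centred k l a b) (F b)) j
      ≡⟨ cong (λ d → conv (F a) (yShift d (F b)) j) (centred-≥≥ k l a b k≤a l≤b) ⟩
    conv (F a) (yShift 1 (F b)) j
      ≡⟨ conv-yShift (F a) (F b) j ⟩
    conv (yShift 1 (F a)) (F b) j
      ≡⟨ conv-cong {yShift 1 (F a)} {yShift 1 (A a)} {F b} {B b} j
                   (yShift-cong 1 (λ u → sym (F-minus-geom-above k≤a u))) (λ t → sym (F-minus-geom-above l≤b t)) ⟩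
    conv (yShift 1 (A a)) (B b) j
      ≡⟨ solve 4 (λ x y z w → x := x :+ con 0ℚ :* y :+ con 0ℚ :* z :- w :* (con 0ℚ :* con 0ℚ)) refl
                 (conv (yShift 1 (A a)) (B b) j) (F b j) (F a j) (δ₀ j) ⟩
    conv (yShift 1 (A a)) (B b) j + 0ℚ * F b j + 0ℚ * F a j - δ₀ j * (0ℚ * 0ℚ)
      ≡⟨ rhs-term-at a b j (cong ⟦_⟧ℚ (<ᵇ-false (≤⇒≯ k≤a))) (cong ⟦_⟧ℚ (<ᵇ-false (≤⇒≯ l≤b))) ⟨
    rhs-term a b j ∎
    where open ℚ-Solver.+-*-Solver

  term-identity-<≥ : ∀ {a b} j → a < k → l ≤ b → conv (F a) (yShift (centred k l a b) (F b)) j ≡ rhs-term a b j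
  term-identity-<≥ {a} {b} j a<k l≤b = begin
    conv (F a) (yShift (centred k l a b) (F b)) j
      ≡⟨ cong (λ d → conv (F a) (yShift d (F b)) j) (centred-<ˡ k l a b a<k) ⟩
    conv (F a) (F b) j
      ≡⟨ conv-cong {F a} {δ₀} {F b} {F b} j (F-small (≤-trans (<⇒≤ a<k) (m≤m+n k l))) (λ _ → refl) ⟩
    conv δ₀ (F b) j
      ≡⟨ conv-δ₀ˡ (F b) j ⟩
    F b j
      ≡⟨ solve 3 (λ y z w → y := con 0ℚ :+ con 1ℚ :* y :+ con 0ℚ :* z :- w :* (con 1ℚ :* con 0ℚ)) refl
                 (F b j) (F a j) (δ₀ j) ⟩
    0ℚ + 1ℚ * F b j + 0ℚ * F a j - δ₀ j * (1ℚ * 0ℚ)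
      ≡⟨ cong (λ x → x + 1ℚ * F b j + 0ℚ * F a j - δ₀ j * (1ℚ * 0ℚ))
              (conv-zeroˡ (B b) j (yShift-zero 1 (F-minus-geom-below a<k (m≤m+n k l)))) ⟨
    conv (yShift 1 (A a)) (B b) j + 1ℚ * F b j + 0ℚ * F a j - δ₀ j * (1ℚ * 0ℚ)
      ≡⟨ rhs-term-at a b j (cong ⟦_⟧ℚ (<ᵇ-true a<k)) (cong ⟦_⟧ℚ (<ᵇ-false (≤⇒≯ l≤b))) ⟨
    rhs-term a b j ∎
    where open ℚ-Solver.+-*-Solver

  term-identity-≥< : ∀ {a b} j → k ≤ a → b < l → conv (F a) (yShift (centred k l a b) (F b)) j ≡ rhs-term a b j
  term-identity-≥< {a} {b} j k≤a b<l = begin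
    conv (F a) (yShift (centred k l a b) (F b)) j
      ≡⟨ cong (λ d → conv (F a) (yShift d (F b)) j) (centred-<ʳ k l a b b<l) ⟩
    conv (F a) (F b) j
      ≡⟨ conv-cong {F a} {F a} {F b} {δ₀} j (λ _ → refl) (F-small (≤-trans (<⇒≤ b<l) (m≤n+m l k))) ⟩
    conv (F a) δ₀ j
      ≡⟨ conv-δ₀ʳ (F a) j ⟩
    F a j
      ≡⟨ solve 3 (λ y z w → z := con 0ℚ :+ con 0ℚ :* y :+ con 1ℚ :* z :- w :* (con 0ℚ :* con 1ℚ)) refl
                 (F b j) (F a j) (δ₀ j) ⟩
    0ℚ + 0ℚ * F b j + 1ℚ * F a j - δ₀ j * (0ℚ * 1ℚ)
      ≡⟨ cong (λ x → x + 0ℚ * F b j + 1ℚ * F a j - δ₀ j * (0ℚ * 1ℚ))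
              (conv-zeroʳ (yShift 1 (A a)) j (F-minus-geom-below b<l (m≤n+m l k))) ⟨
    conv (yShift 1 (A a)) (B b) j + 0ℚ * F b j + 1ℚ * F a j - δ₀ j * (0ℚ * 1ℚ)
      ≡⟨ rhs-term-at a b j (cong ⟦_⟧ℚ (<ᵇ-false (≤⇒≯ k≤a))) (cong ⟦_⟧ℚ (<ᵇ-true b<l)) ⟨
    rhs-term a b j ∎
    where open ℚ-Solver.+-*-Solver

  term-identity-<< : ∀ {a b} j → a < k → b < l → conv (F a) (yShift (centred k l a b) (F b)) j ≡ rhs-term a b j
  term-identity-<< {a} {b} j a<k b<l = begin
    conv (F a) (yShift (centred k l a b) (F b)) j
      ≡⟨ cong (λ d → conv (F a) (yShift d (F b)) j) (centred-<ʳ k l a b b<l) ⟩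
    conv (F a) (F b) j
      ≡⟨ conv-cong {F a} {δ₀} {F b} {δ₀} j a-small b-small ⟩
    conv δ₀ δ₀ j
      ≡⟨ conv-δ₀ˡ δ₀ j ⟩
    δ₀ j
      ≡⟨ solve 1 (λ w → w := con 0ℚ :+ con 1ℚ :* w :+ con 1ℚ :* w :- w :* (con 1ℚ :* con 1ℚ)) refl (δ₀ j) ⟩
    0ℚ + 1ℚ * δ₀ j + 1ℚ * δ₀ j - δ₀ j * (1ℚ * 1ℚ)
      ≡⟨ cong₂ (λ x y → x + 1ℚ * y + 1ℚ * δ₀ j - δ₀ j * (1ℚ * 1ℚ))
               (conv-zeroˡ (B b) j (yShift-zero 1 (F-minus-geom-below a<k (m≤m+n k l)))) (b-small j) ⟨
    conv (yShift 1 (A a)) (B b) j + 1ℚ * F b j + 1ℚ * δ₀ j - δ₀ j * (1ℚ * 1ℚ)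
      ≡⟨ cong (λ z → conv (yShift 1 (A a)) (B b) j + 1ℚ * F b j + 1ℚ * z - δ₀ j * (1ℚ * 1ℚ)) (a-small j) ⟨
    conv (yShift 1 (A a)) (B b) j + 1ℚ * F b j + 1ℚ * F a j - δ₀ j * (1ℚ * 1ℚ)
      ≡⟨ rhs-term-at a b j (cong ⟦_⟧ℚ (<ᵇ-true a<k)) (cong ⟦_⟧ℚ (<ᵇ-true b<l)) ⟨
    rhs-term a b j ∎
    where
    open ℚ-Solver.+-*-Solver
    a-small : ∀ u → F a u ≡ δ₀ u
    a-small = F-small (≤-trans (<⇒≤ a<k) (m≤m+n k l))
    b-small : ∀ u → F b u ≡ δ₀ u
    b-small = F-small (≤-trans (<⇒≤ b<l) (m≤n+m l k))

  term-identity : ∀ a b j → conv (F a) (yShift (centred k l a b) (F b)) j ≡ rhs-term a b j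
  term-identity a b j with a <? k | b <? l
  ... | no a≮k  | no b≮l  = term-identity-≥≥ j (≮⇒≥ a≮k) (≮⇒≥ b≮l)
  ... | yes a<k | no b≮l  = term-identity-<≥ j a<k (≮⇒≥ b≮l)
  ... | no a≮k  | yes b<l = term-identity-≥< j (≮⇒≥ a≮k) b<l
  ... | yes a<k | yes b<l = term-identity-<< j a<k b<l

  rhs-expansion : ∀ n j →
    (Y ⊛ A ⊛ B ⊕ (const (+ 2 / 1) ⊖ X^ k ⊖ X^ l) ⊛ inv1-X ⊛ F
       ⊖ (const 1ℚ ⊖ X^ k ⊖ X^ l ⊕ X^ (k ℕ.+ l)) ⊛ inv1-X ⊛ inv1-X) n j ≡
    sumTo n (λ a → rhs-term a (n ∸ a) j)
  rhs-expansion n j = begin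
    (Y ⊛ A ⊛ B) n j + ((const (+ 2 / 1) ⊖ X^ k ⊖ X^ l) ⊛ inv1-X ⊛ F) n j
      - ((const 1ℚ ⊖ X^ k ⊖ X^ l ⊕ X^ (k ℕ.+ l)) ⊛ inv1-X ⊛ inv1-X) n j
      ≡⟨ cong₂ _-_ (cong₂ _+_ (∑-cong n (λ a _ → Y-row a)) (⊛-two-minus-geoms k l F n j))
                   (trans (⊛-window k l n j) (sym (∑-distribˡ n (δ₀ j) (λ a → ⟦ a <ᵇ k ⟧ℚ * ⟦ n ∸ a <ᵇ l ⟧ℚ)))) ⟩
    ∑x + (∑y + ∑z) - ∑w
      ≡⟨ cong (_- ∑w) (sym (+-assoc ∑x ∑y ∑z)) ⟩
    ∑x + ∑y + ∑z - ∑w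
      ≡⟨ cong (_- ∑w) (cong (_+ ∑z) (∑-distrib-+ n x y)) ⟨
    sumTo n (λ a → x a + y a) + ∑z - ∑w
      ≡⟨ cong (_- ∑w) (∑-distrib-+ n (λ a → x a + y a) z) ⟨
    sumTo n (λ a → x a + y a + z a) - ∑w
      ≡⟨ ∑-distrib-- n (λ a → x a + y a + z a) w ⟨
    sumTo n (λ a → x a + y a + z a - w a) ∎
    where
    Y-row : ∀ a → conv ((Y ⊛ A) a) (B (n ∸ a)) j ≡ conv (yShift 1 (A a)) (B (n ∸ a)) j
    Y-row a = conv-cong {(Y ⊛ A) a} {yShift 1 (A a)} {B (n ∸ a)} {B (n ∸ a)} j (Y-⊛ A a) (λ _ → refl)
    x y z w : ℕ → ℚ
    x a = conv (yShift 1 (A a)) (B (n ∸ a)) j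
    y a = ⟦ a <ᵇ k ⟧ℚ * F (n ∸ a) j
    z a = ⟦ n ∸ a <ᵇ l ⟧ℚ * F a j
    w a = δ₀ j * (⟦ a <ᵇ k ⟧ℚ * ⟦ n ∸ a <ᵇ l ⟧ℚ)
    ∑x ∑y ∑z ∑w : ℚ
    ∑x = sumTo n x
    ∑y = sumTo n y
    ∑z = sumTo n z
    ∑w = sumTo n w

open import Data.Nat using (_+_; _∸_; z≤n)
open import Data.Integer using (+_)
open import Data.Rational using (ℚ; 0ℚ; 1ℚ)
open import Data.Product using (_×_; _,_)
open import Relation.Binary.PropositionalEquality using (trans; sym)
open import Function using (_∘_)

mainTheorem6 : (k l : ℕ) →
    let Pₖₗ = P k l
        one = const 1ℚ
        two = const (Data.Rational._/_ (+ 2) 1)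
    in (∂x Pₖₗ ≐ Y ⊛ (Pₖₗ ⊖ (one ⊖ X^ k) ⊛ inv1-X) ⊛ (Pₖₗ ⊖ (one ⊖ X^ l) ⊛ inv1-X)
                ⊕ (two ⊖ X^ k ⊖ X^ l) ⊛ inv1-X ⊛ Pₖₗ
                ⊖ (one ⊖ X^ k ⊖ X^ l ⊕ X^ (k + l)) ⊛ inv1-X ⊛ inv1-X)
       × (Pₖₗ 0 0 ≡ 1ℚ) × (∀ j → Pₖₗ 0 (suc j) ≡ 0ℚ)
mainTheorem6 k l =
  (λ n j → trans (∂x-P n j) (trans (∑-cong n (λ a _ → term-identity a (n ∸ a) j)) (sym (rhs-expansion n j)))) ,
  P-small z≤n 0 ,
  P-small z≤n ∘ suc
  where
  open GeneratingFunction k l using (∂x-P; P-small)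
  open Expansion k l (P k l) P-small using (term-identity; rhs-expansion)
  open SeriesCoefficients using (∑-cong)
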